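{- Let $P=\{p_1,\ldots,p_d\}$ and $Q=\{q_1,\ldots,q_d\}$ be finite partially ordered sets. Then $$\mathrm{vol}(\Gamma(\mathcal{C}(P),-\mathcal{C}(Q)))=\sum_{W\subset[d]}\frac{e(\Delta_W(P,Q))}{d!}.$$
   Context: $[d]=\{1,\ldots,d\}$, $\mathbf{e}_i$ unit coordinate vectors, $\mathrm{vol}$ the usual Euclidean volume in $\mathbb{R}^d$. For $I\subset P$, $\rho(I)=\sum_{p_i\in I}\mathbf{e}_i$ (similarly for $Q$). The chain polytope $\mathcal{C}(P)=\mathrm{conv}\{\rho(A): A\text{ antichain of }P\}$ (antichains include $\emptyset$), and $\Gamma(\mathcal{C}(P),-\mathcal{C}(Q))=\mathrm{conv}(\mathcal{C}(P)\cup(-\mathcal{C}(Q)))$. For $W\subset[d]$, $\overline W=[d]\setminus W$, and $\Delta_W(P,Q)$ is the ordinal sum $P_W\oplus Q_{\overline W}$ of the induced subposets $P_W=\{p_i:i\in W\}$ and $Q_{\overline W}=\{q_j:j\in\overline W\}$ (order of $P$ on $P_W$, of $Q$ on $Q_{\overline W}$, and every element of $P_W$ below every element of $Q_{\overline W}$). Let $R=\{r_1,\dots,r_d\}$ be the poset with $r_i\le r_j$ iff the element of $\Delta_W(P,Q)$ with index $i$ ($p_i$ if $i\in W$, $q_i$ otherwise) is $\le$ the element with index $j$. $e(\Delta_W(P,Q))$ is the number of permutations $i_1\cdots i_d$ of $[d]$ with $a<b$ whenever $r_{i_a}<r_{i_b}$. -}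

module Defs where

open import Data.Bool using (Bool; true; false; T; if_then_else_; _∧_; not)
open import Data.Nat as ℕ using (ℕ; zero; suc)
import Data.Nat.Properties as NP
import Data.Nat.ListAction as LA
open import Data.Integer as ℤ using (ℤ)
open import Data.Rational as ℚ using (ℚ; 0ℚ; 1ℚ; _+_; _*_; _-_; -_; _≤_; _<_; ∣_∣)
open import Data.Fin as Fin using (Fin; _≟_)
import Data.Fin.Properties as FinP
open import Data.Fin.Subset using (Subset)
open import Data.Vec as Vec using (Vec; []; _∷_; lookup)
open import Data.List as List using (List; []; _∷_; length; filter; concatMap; map; foldr; allFin)
open import Data.List.Relation.Unary.All using (All)
open import Data.List.Relation.Unary.Unique.Propositional using (Unique)
open import Data.List.Membership.Propositional using (_∈_)
open import Data.Product using (Σ; _×_; _,_; ∃)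
open import Function.Bundles using (_⇔_)
open import Relation.Nullary using (¬_; Dec; yes; no)
open import Relation.Nullary.Decidable using (⌊_⌋)
open import Relation.Binary.PropositionalEquality using (_≡_; _≢_)

-- Finite posets on the index set [d] = Fin d.
-- The element p_i is represented by the index i : Fin d; the order is
-- a Bool-valued relation (finite posets have decidable order).

record FinPoset (d : ℕ) : Set where
  field
    leq     : Fin d → Fin d → Bool
    refl    : ∀ i → T (leq i i)
    antisym : ∀ i j → T (leq i j) → T (leq j i) → i ≡ j
    trans   : ∀ i j k → T (leq i j) → T (leq j k) → T (leq i k)
open FinPoset public

Point : ℕ → Set
Point d = Fin d → ℚ

weightSum : ∀ {d} → List (ℚ × Point d) → ℚ
weightSum = foldr (λ { (l , _) s → l + s }) 0ℚ

combCoord : ∀ {d} → List (ℚ × Point d) → Fin d → ℚ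
combCoord ws i = foldr (λ { (l , v) s → l * v i + s }) 0ℚ ws

Conv : ∀ {d} → (Point d → Set) → (Point d → Set)
Conv {d} S x = Σ (List (ℚ × Point d)) λ ws →
    All (λ { (l , v) → (0ℚ ≤ l) × S v }) ws
  × (weightSum ws ≡ 1ℚ)
  × (∀ i → combCoord ws i ≡ x i)

IsAntichain : ∀ {d} → FinPoset d → Subset d → Set
IsAntichain P A = ∀ i j → T (lookup A i) → T (lookup A j) → i ≢ j → ¬ T (leq P i j)

ρ : ∀ {d} → Subset d → Point d
ρ A i = if lookup A i then 1ℚ else 0ℚ

ChainPolytope : ∀ {d} → FinPoset d → Point d → Set
ChainPolytope {d} P = Conv (λ x → Σ (Subset d) λ A → IsAntichain P A × (x ≡ ρ A))

neg : ∀ {d} → (Point d → Set) → (Point d → Set)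
neg K x = K (λ i → - x i)

Gamma : ∀ {d} → FinPoset d → FinPoset d → Point d → Set
Gamma P Q = Conv (λ x → ChainPolytope P x ⊎' neg (ChainPolytope Q) x)
  where
  open import Data.Sum renaming (_⊎_ to _⊎'_)

-- Euclidean volume (Jordan content) via grid sampling:
-- vol K = lim_{n→∞} #(K ∩ (1/n)ℤ^d) / n^d.

GridCount : ∀ {d} → (Point d → Set) → (n : ℕ) → .{{_ : ℕ.NonZero n}} → ℕ → Set
GridCount {d} K n c = Σ (List (Vec ℤ d)) λ L →
    Unique L
  × (∀ z → (z ∈ L) ⇔ K (λ i → lookup z i ℚ./ n))
  × (length L ≡ c)

HasVolume : ∀ {d} → (Point d → Set) → ℚ → Set
HasVolume {d} K V = ∀ (ε : ℚ) → 0ℚ < ε → ∃ λ N → ∀ n → N ℕ.≤ n →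
  (nz : ℕ.NonZero n) →
  ∃ λ c → GridCount K n {{nz}} c
        × (∣ ℚ._/_ (ℤ.+ c) (n ℕ.^ d) {{NP.m^n≢0 n d {{nz}}}} - V ∣ < ε)
  where import Data.Nat.Base

-- Δ_W(P,Q) = P_W ⊕ Q_{W̄}, as the poset R on indices [d].

inW : ∀ {d} → Subset d → Fin d → Bool
inW W i = lookup W i

leqΔ : ∀ {d} → FinPoset d → FinPoset d → Subset d → Fin d → Fin d → Bool
leqΔ P Q W i j with inW W i | inW W j
... | true  | true  = leq P i j
... | false | false = leq Q i j
... | true  | false = true
... | false | true  = false

ltΔ : ∀ {d} → FinPoset d → FinPoset d → Subset d → Fin d → Fin d → Bool
ltΔ P Q W i j = leqΔ P Q W i j ∧ not ⌊ i ≟ j ⌋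

allVecs : ∀ {d} (n : ℕ) → List (Vec (Fin d) n)
allVecs zero = [] ∷ []
allVecs {d} (suc n) = concatMap (λ x → map (x ∷_) (allVecs n)) (allFin d)

allB : ∀ {d} → (Fin d → Bool) → Bool
allB {d} f = foldr (λ i b → f i ∧ b) true (allFin d)

isPerm : ∀ {d} → Vec (Fin d) d → Bool
isPerm σ = allB (λ a → allB (λ b → not ⌊ lookup σ a ≟ lookup σ b ⌋ Data.Bool.∨ ⌊ a ≟ b ⌋))
  where import Data.Bool

isLinExt : ∀ {d} → FinPoset d → FinPoset d → Subset d → Vec (Fin d) d → Bool
isLinExt P Q W σ = allB (λ a → allB (λ b →
  not (ltΔ P Q W (lookup σ a) (lookup σ b)) Data.Bool.∨ ⌊ a Fin.<? b ⌋))
  where import Data.Bool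

e : ∀ {d} → FinPoset d → FinPoset d → Subset d → ℕ
e {d} P Q W = length (filter (λ σ → T? (isPerm σ ∧ isLinExt P Q W σ)) (allVecs d))
  where open import Data.Bool.Properties using () renaming (T? to T?)

allSubsets : (n : ℕ) → List (Subset n)
allSubsets zero = [] ∷ []
allSubsets (suc n) = concatMap (λ b → map (b ∷_) (allSubsets n)) (true ∷ false ∷ [])

rhs : ∀ {d} → FinPoset d → FinPoset d → ℚ
rhs {d} P Q = ℚ._/_ (ℤ.+ LA.sum (map (e P Q) (allSubsets d))) (d ℕ.!) {{d NP.!≢0}}

-- For z ∈ ℤᵈ let W be the set of positive coordinates and let H(i) be the largest
-- |z|-weight of a chain of Δ_W = P_W ⊕ Q_W̄ starting at i. Then z/n ∈ Γ(C(P), −C(Q))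
-- iff H ≤ n. Necessity: the signed indicator of a chain is a linear functional that
-- is ≤ 1 on every vertex ±ρ(A), because a chain meets an antichain at most once.
-- Sufficiency: the layers {a : max_{b > a} H(b) < t ≤ H(a)}, t = 1, …, n, are
-- antichains of Δ_W lying entirely in W or entirely outside it, and the average of
-- their signed indicators is z/n.
-- Conversely z is determined by W and H, since |zᵢ| = H(i) − max_{j > i} H(j).
-- Reading H along a linear extension σ of Δ_W: every strictly decreasing sequence in
-- [1, n] is the H of exactly one lattice point (which also determines W and σ), and
-- every lattice point arises from a weakly decreasing sequence in [0, n] along a
-- suitable σ. With E = Σ_W e(Δ_W) the number c of lattice points of nΓ therefore
-- satisfies E (n − d)ᵈ ≤ d! c ≤ E (n + d + 1)ᵈ, so c / nᵈ → E / d!.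

module Submission where

open import Data.Nat using (ℕ)
import Defs

module Folds where

  open import Data.Nat
  open import Data.Nat.Properties
  open import Data.Fin using (Fin; zero; suc; toℕ)
  import Data.Fin.Properties as FinP
  open import Data.Bool using (Bool; true; false; T; if_then_else_; _∧_; _∨_)
  open import Data.Bool.Properties using (∧-zeroʳ)
  open import Data.Sum using (_⊎_; inj₁; inj₂)
  open import Data.Product using (Σ; _,_)
  open import Data.Empty using (⊥-elim)
  open import Relation.Nullary using (¬_)
  open import Relation.Binary.PropositionalEquality
  open import Algebra.Properties.CommutativeSemigroup +-commutativeSemigroup using (x∙yz≈y∙xz)
  open import Algebra.Properties.Semiring.Sum +-*-semiring using (sum-replicate-zero)
  open import Algebra.Properties.Semiring.Sum +-*-semiring public using (sum)
  open import Data.Vec.Functional using (tail)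

  private variable
    d : ℕ

  max : (Fin d → ℕ) → ℕ
  max {zero} f = 0
  max {suc d} f = f zero ⊔ max (tail f)

  indicator : Bool → ℕ
  indicator b = if b then 1 else 0

  count : (Fin d → Bool) → ℕ
  count f = sum (λ i → indicator (f i))

  sum-mono-≤ : (f g : Fin d → ℕ) → (∀ i → f i ≤ g i) → sum f ≤ sum g
  sum-mono-≤ {zero} f g le = z≤n
  sum-mono-≤ {suc d} f g le = +-mono-≤ (le zero) (sum-mono-≤ (tail f) (tail g) (λ i → le (suc i)))

  f≤max : (f : Fin d → ℕ) → ∀ i → f i ≤ max f
  f≤max {suc d} f zero = m≤m⊔n _ _
  f≤max {suc d} f (suc i) = ≤-trans (f≤max (tail f) i) (m≤n⊔m (f zero) _)

  max-lub : (f : Fin d → ℕ) → ∀ m → (∀ i → f i ≤ m) → max f ≤ m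
  max-lub {zero} f m le = z≤n
  max-lub {suc d} f m le = ⊔-lub (le zero) (max-lub (tail f) m (λ i → le (suc i)))

  max≡0⊎attained : (f : Fin d → ℕ) → max f ≡ 0 ⊎ Σ (Fin d) (λ i → max f ≡ f i)
  max≡0⊎attained {zero} f = inj₁ refl
  max≡0⊎attained {suc d} f with ⊔-sel (f zero) (max (tail f))
  ... | inj₁ eq = inj₂ (zero , eq)
  ... | inj₂ eq with max≡0⊎attained (tail f)
  ...   | inj₁ eq₀ = inj₁ (trans eq eq₀)
  ...   | inj₂ (i , eqᵢ) = inj₂ (suc i , trans eq eqᵢ)

  max-cong : (f g : Fin d → ℕ) → (∀ i → f i ≡ g i) → max f ≡ max g
  max-cong {zero} f g eq = refl
  max-cong {suc d} f g eq = cong₂ _⊔_ (eq zero) (max-cong (tail f) (tail g) (λ i → eq (suc i)))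

  indicator-mono : ∀ a b → (T a → T b) → indicator a ≤ indicator b
  indicator-mono false b _ = z≤n
  indicator-mono true true _ = ≤-refl
  indicator-mono true false imp = ⊥-elim (imp _)

  indicator≤1 : ∀ b → indicator b ≤ 1
  indicator≤1 false = z≤n
  indicator≤1 true = ≤-refl

  count-mono-≤ : (f g : Fin d → Bool) → (∀ i → T (f i) → T (g i)) → count f ≤ count g
  count-mono-≤ f g f⊆g = sum-mono-≤ _ _ (λ i → indicator-mono (f i) (g i) (f⊆g i))

  count-mono-< : (f g : Fin d → Bool) → (∀ i → T (f i) → T (g i)) →
    ∀ j → T (g j) → ¬ T (f j) → count f < count g
  count-mono-< {suc d} f g f⊆g zero gj ¬fj with f zero | g zero
  ... | true  | _     = ⊥-elim (¬fj _)
  ... | false | true  = s≤s (count-mono-≤ (tail f) (tail g) (λ i → f⊆g (suc i)))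
  ... | false | false = ⊥-elim gj
  count-mono-< {suc d} f g f⊆g (suc j) gj ¬fj =
    +-mono-≤-< (indicator-mono (f zero) (g zero) (f⊆g zero)) (count-mono-< (tail f) (tail g) (λ i → f⊆g (suc i)) j gj ¬fj)

  count≤ : (f : Fin d → Bool) → count f ≤ d
  count≤ {zero} f = z≤n
  count≤ {suc d} f = +-mono-≤ (indicator≤1 (f zero)) (count≤ (tail f))

  count< : (f : Fin d → Bool) → ∀ j → ¬ T (f j) → count f < d
  count< {suc d} f zero ¬fj with f zero
  ... | true  = ⊥-elim (¬fj _)
  ... | false = s≤s (count≤ (tail f))
  count< {suc d} f (suc j) ¬fj = +-mono-≤-< (indicator≤1 (f zero)) (count< (tail f) j ¬fj)

  count-none : (f : Fin d → Bool) → (∀ i → ¬ T (f i)) → count f ≡ 0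
  count-none {zero} f none = refl
  count-none {suc d} f none with f zero in eq
  ... | true  = ⊥-elim (none zero (subst T (sym eq) _))
  ... | false = count-none (tail f) (λ i → none (suc i))

  count≤1 : (f : Fin d → Bool) → (∀ a b → T (f a) → T (f b) → a ≡ b) → count f ≤ 1
  count≤1 {zero} f unique = z≤n
  count≤1 {suc d} f unique with f zero in eq
  ... | true  = ≤-reflexive (cong suc (count-none (tail f)
                  (λ i fi → FinP.0≢1+n (unique zero (suc i) (subst T (sym eq) _) fi))))
  ... | false = count≤1 (tail f) (λ a b fa fb → FinP.suc-injective (unique (suc a) (suc b) fa fb))

  _==_ : Fin d → Fin d → Bool
  a == b = toℕ a ≡ᵇ toℕ b

  ==⇒≡ : ∀ (a b : Fin d) → T (a == b) → a ≡ b
  ==⇒≡ a b eq = FinP.toℕ-injective (≡ᵇ⇒≡ (toℕ a) (toℕ b) eq)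

  sumOver : (Fin d → Bool) → (Fin d → ℕ) → ℕ
  sumOver S y = sum (λ a → if S a then y a else 0)

  sumOver-singleton : (y : Fin d → ℕ) → ∀ i → sumOver (λ a → a == i) y ≡ y i
  sumOver-singleton {suc d} y zero =
    trans (cong (y zero +_) (sum-replicate-zero d)) (+-identityʳ _)
  sumOver-singleton {suc d} y (suc i) = sumOver-singleton {d} (tail y) i

  sumOver-insert : (S : Fin d → Bool) (y : Fin d → ℕ) → ∀ i → ¬ T (S i) →
    sumOver (λ a → a == i ∨ S a) y ≡ y i + sumOver S y
  sumOver-insert {suc d} S y zero ¬Si with S zero
  ... | true  = ⊥-elim (¬Si _)
  ... | false = refl
  sumOver-insert {suc d} S y (suc i) ¬Si = begin
    y₀ + sumOver (λ a → a == i ∨ tail S a) (tail y) ≡⟨ cong (y₀ +_) (sumOver-insert (tail S) (tail y) i ¬Si) ⟩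
    y₀ + (y (suc i) + sumOver (tail S) (tail y))     ≡⟨ x∙yz≈y∙xz y₀ (y (suc i)) _ ⟩
    y (suc i) + (y₀ + sumOver (tail S) (tail y))     ∎
    where
    open ≡-Reasoning
    y₀ = if S zero then y zero else 0

  countUpTo : ℕ → (ℕ → Bool) → ℕ
  countUpTo zero    f = 0
  countUpTo (suc t) f = indicator (f (suc t)) + countUpTo t f

  countUpTo-interval : ∀ n M H → countUpTo n (λ t → (M <ᵇ t) ∧ (t ≤ᵇ H)) ≡ (n ⊓ H) ∸ M
  countUpTo-interval zero M H = sym (0∸n≡0 M)
  countUpTo-interval (suc n) M H with n <ᵇ H in n<ᵇH | M <ᵇ suc n in M<ᵇ1+n
  ... | false | b = begin
    indicator (b ∧ false) + countUpTo n _ ≡⟨ cong (λ c → indicator c + _) (∧-zeroʳ b) ⟩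
    countUpTo n _                         ≡⟨ countUpTo-interval n M H ⟩
    n ⊓ H ∸ M                             ≡⟨ cong (_∸ M) (trans (m≥n⇒m⊓n≡n H≤n) (sym (m≥n⇒m⊓n≡n (m≤n⇒m≤1+n H≤n)))) ⟩
    suc n ⊓ H ∸ M                         ∎
    where
    open ≡-Reasoning
    H≤n : H ≤ n
    H≤n = ≮⇒≥ (λ n<H → subst T n<ᵇH (<⇒<ᵇ n<H))
  ... | true | true = begin
    suc (countUpTo n _) ≡⟨ cong suc (countUpTo-interval n M H) ⟩
    suc (n ⊓ H ∸ M)     ≡⟨ cong (λ k → suc (k ∸ M)) (m≤n⇒m⊓n≡m (<⇒≤ 1+n≤H)) ⟩
    suc (n ∸ M)         ≡⟨ sym (+-∸-assoc 1 (<ᵇ⇒< M (suc n) (subst T (sym M<ᵇ1+n) _))) ⟩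
    suc n ∸ M           ≡⟨ cong (_∸ M) (sym (m≤n⇒m⊓n≡m 1+n≤H)) ⟩
    suc n ⊓ H ∸ M       ∎
    where
    open ≡-Reasoning
    1+n≤H = <ᵇ⇒< n H (subst T (sym n<ᵇH) _)
  ... | true | false = begin
    countUpTo n _ ≡⟨ countUpTo-interval n M H ⟩
    n ⊓ H ∸ M     ≡⟨ cong (_∸ M) (m≤n⇒m⊓n≡m (<⇒≤ 1+n≤H)) ⟩
    n ∸ M         ≡⟨ m≤n⇒m∸n≡0 (<⇒≤ n<M) ⟩
    0             ≡⟨ sym (m≤n⇒m∸n≡0 n<M) ⟩
    suc n ∸ M     ≡⟨ cong (_∸ M) (sym (m≤n⇒m⊓n≡m 1+n≤H)) ⟩
    suc n ⊓ H ∸ M ∎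
    where
    open ≡-Reasoning
    1+n≤H = <ᵇ⇒< n H (subst T (sym n<ᵇH) _)
    n<M : n < M
    n<M = ≮⇒≥ (λ M<1+n → subst T M<ᵇ1+n (<⇒<ᵇ M<1+n))

module FinSort where

  open import Data.Nat as ℕ using (ℕ; zero; suc; z≤n; s≤s; _<ᵇ_)
  open import Data.Nat.Properties as ℕP using (<-cmp; <ᵇ⇒<; <⇒<ᵇ)
  open import Data.Fin using (Fin; zero; suc; toℕ; fromℕ<; opposite; _≤_; _<_)
  open import Data.Fin.Properties using (any?; _≟_; injective⇒≤; punchOut-injective; toℕ-fromℕ<; toℕ<n; toℕ-injective; opposite-prop; opposite-involutive)
  open import Data.Bool using (T)
  open import Data.Product using (Σ; _,_; proj₁; proj₂)
  open import Data.Empty using (⊥-elim)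
  open import Function using (_∘_)
  open import Relation.Nullary using (¬_; yes; no)
  open import Relation.Binary using (_Preserves_⟶_; tri<; tri≈; tri>)
  open import Relation.Binary.PropositionalEquality
  open Folds using (count; count-mono-<; count<)

  private variable
    d : ℕ

  injective⇒surjective : (f : Fin d → Fin d) → (∀ {i j} → f i ≡ f j → i ≡ j) → ∀ a → Σ (Fin d) λ i → f i ≡ a
  injective⇒surjective {suc d} f inj a with any? (λ i → f i ≟ a)
  ... | yes hit = hit
  ... | no miss = ⊥-elim (ℕP.<-irrefl refl (injective⇒≤ (inj ∘ punchOut-injective (≢a _) (≢a _))))
    where
    ≢a : ∀ i → a ≢ f i
    ≢a i eq = miss (i , sym eq)

  strictMono⇒≥ : (f : Fin d → Fin d) → f Preserves _<_ ⟶ _<_ → ∀ a → a ≤ f a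
  strictMono⇒≥ {d} f mono a = go (toℕ a) a refl
    where
    go : ∀ k (a : Fin d) → toℕ a ≡ k → k ℕ.≤ toℕ (f a)
    go zero a _ = z≤n
    go (suc k) a a≡1+k = ℕP.≤-<-trans (go k pred (toℕ-fromℕ< k<d)) (mono pred<a)
      where
      k<d : k ℕ.< d
      k<d = ℕP.<-trans (ℕP.≤-reflexive (sym a≡1+k)) (toℕ<n a)
      pred<a : toℕ (fromℕ< k<d) ℕ.< toℕ a
      pred<a = ℕP.≤-reflexive (trans (cong suc (toℕ-fromℕ< k<d)) (sym a≡1+k))
      pred = fromℕ< k<d

  opposite-< : ∀ {a b : Fin d} → a < b → opposite b < opposite a
  opposite-< {a = a} {b} a<b =
    subst₂ ℕ._<_ (sym (opposite-prop b)) (sym (opposite-prop a)) (ℕP.∸-monoʳ-< (s≤s a<b) (toℕ<n b))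

  strictMono⇒id : (f : Fin d → Fin d) → f Preserves _<_ ⟶ _<_ → ∀ a → f a ≡ a
  strictMono⇒id {d} f mono a = toℕ-injective (ℕP.≤-antisym fa≤a (strictMono⇒≥ f mono a))
    where
    -- conjugating by opposite reverses the order, so strictMono⇒≥ also bounds f a from above
    reflected : opposite a ≤ opposite (f a)
    reflected = subst (opposite a ≤_) (cong (opposite ∘ f) (opposite-involutive a))
      (strictMono⇒≥ (opposite ∘ f ∘ opposite) (opposite-< ∘ mono ∘ opposite-<) (opposite a))
    fa≤a : f a ≤ a
    fa≤a = ℕP.≤-pred (ℕP.∸-cancelʳ-≤ (toℕ<n (f a))
      (subst₂ ℕ._≤_ (opposite-prop a) (opposite-prop (f a)) reflected))

  <ᵇ-irrefl : ∀ n → ¬ T (n <ᵇ n)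
  <ᵇ-irrefl n n<n = ℕP.<-irrefl refl (<ᵇ⇒< n n n<n)

  module SortByKey (κ : Fin d → ℕ) (κ-injective : ∀ {i j} → κ i ≡ κ j → i ≡ j) where

    rank : Fin d → ℕ
    rank i = count (λ j → κ i <ᵇ κ j)

    rank-< : ∀ {i j} → κ j ℕ.< κ i → rank i ℕ.< rank j
    rank-< {i} {j} κj<κi = count-mono-< _ _ above-i⇒above-j i (<⇒<ᵇ κj<κi) (<ᵇ-irrefl (κ i))
      where
      above-i⇒above-j : ∀ k → T (κ i <ᵇ κ k) → T (κ j <ᵇ κ k)
      above-i⇒above-j k κi<κk = <⇒<ᵇ (ℕP.<-trans κj<κi (<ᵇ⇒< (κ i) (κ k) κi<κk))

    rank<d : ∀ i → rank i ℕ.< d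
    rank<d i = count< _ i (<ᵇ-irrefl (κ i))

    slot : Fin d → Fin d
    slot i = fromℕ< (rank<d i)

    toℕ-slot : ∀ i → toℕ (slot i) ≡ rank i
    toℕ-slot i = toℕ-fromℕ< (rank<d i)

    rank-injective : ∀ {i j} → rank i ≡ rank j → i ≡ j
    rank-injective {i} {j} rank≡ with <-cmp (κ i) (κ j)
    ... | tri< κi<κj _ _ = ⊥-elim (ℕP.<-irrefl (sym rank≡) (rank-< κi<κj))
    ... | tri≈ _ κi≡κj _ = κ-injective κi≡κj
    ... | tri> _ _ κj<κi = ⊥-elim (ℕP.<-irrefl rank≡ (rank-< κj<κi))

    slot-injective : ∀ {i j} → slot i ≡ slot j → i ≡ j
    slot-injective {i} {j} eq = rank-injective (trans (sym (toℕ-slot i)) (trans (cong toℕ eq) (toℕ-slot j)))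

    sorted : Fin d → Fin d
    sorted a = proj₁ (injective⇒surjective slot slot-injective a)

    slot-sorted : ∀ a → slot (sorted a) ≡ a
    slot-sorted a = proj₂ (injective⇒surjective slot slot-injective a)

    sorted-injective : ∀ {a b} → sorted a ≡ sorted b → a ≡ b
    sorted-injective {a} {b} eq = trans (sym (slot-sorted a)) (trans (cong slot eq) (slot-sorted b))

    rank-sorted : ∀ a → rank (sorted a) ≡ toℕ a
    rank-sorted a = trans (sym (toℕ-slot (sorted a))) (cong toℕ (slot-sorted a))

    sorted-reflects : ∀ {a b} → κ (sorted b) ℕ.< κ (sorted a) → a < b
    sorted-reflects {a} {b} lt = subst₂ ℕ._<_ (rank-sorted a) (rank-sorted b) (rank-< lt)

    sorted-decreasing : ∀ {a b} → a < b → κ (sorted b) ℕ.< κ (sorted a)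
    sorted-decreasing {a} {b} a<b with <-cmp (κ (sorted b)) (κ (sorted a))
    ... | tri< lt _ _ = lt
    ... | tri≈ _ eq _ = ⊥-elim (ℕP.<-irrefl (cong toℕ (sorted-injective (κ-injective (sym eq)))) a<b)
    ... | tri> _ _ gt = ⊥-elim (ℕP.<-asym a<b (sorted-reflects gt))

module Height {d : ℕ} (R : Defs.FinPoset d) where

  open import Data.Nat hiding (_≟_)
  open import Data.Nat.Properties hiding (_≟_)
  open import Data.Fin using (Fin; _≟_)
  open import Data.Bool using (Bool; true; false; T; if_then_else_; _∧_; _∨_; not)
  open import Data.Bool.Properties using (T-∧; T-∨)
  open import Data.Sum using (_⊎_; inj₁; inj₂)
  open import Data.Product using (_,_; proj₁; proj₂)
  open import Data.Empty using (⊥-elim)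
  open import Function using (Equivalence)
  open import Relation.Nullary using (¬_)
  open import Relation.Nullary.Decidable using (⌊_⌋; toWitnessFalse; fromWitnessFalse)
  open import Relation.Binary.PropositionalEquality
  open import Defs using (FinPoset; leq)
  open Folds
  private module R = FinPoset R
  open Equivalence using (to; from)

  _⊏_ : Fin d → Fin d → Bool
  i ⊏ j = leq R i j ∧ not ⌊ i ≟ j ⌋

  ⊏⇒≤ : ∀ {i j} → T (i ⊏ j) → T (leq R i j)
  ⊏⇒≤ {i} {j} i⊏j = proj₁ (to (T-∧ {leq R i j}) i⊏j)

  ⊏⇒≢ : ∀ {i j} → T (i ⊏ j) → i ≢ j
  ⊏⇒≢ {i} {j} i⊏j = toWitnessFalse {a? = i ≟ j} (proj₂ (to (T-∧ {leq R i j}) i⊏j))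

  ≤∧≢⇒⊏ : ∀ {i j} → T (leq R i j) → i ≢ j → T (i ⊏ j)
  ≤∧≢⇒⊏ {i} {j} i≤j i≢j = from (T-∧ {leq R i j}) (i≤j , fromWitnessFalse i≢j)

  ⊏-irrefl : ∀ i → ¬ T (i ⊏ i)
  ⊏-irrefl i i⊏i = ⊏⇒≢ i⊏i refl

  ⊏⇒≱ : ∀ {i j} → T (i ⊏ j) → ¬ T (leq R j i)
  ⊏⇒≱ {i} {j} i⊏j j≤i = ⊏⇒≢ i⊏j (R.antisym i j (⊏⇒≤ i⊏j) j≤i)

  ⊏-trans : ∀ {i j k} → T (i ⊏ j) → T (j ⊏ k) → T (i ⊏ k)
  ⊏-trans {i} {j} {k} i⊏j j⊏k = ≤∧≢⇒⊏ (R.trans i j k (⊏⇒≤ i⊏j) (⊏⇒≤ j⊏k))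
    (λ { refl → ⊏⇒≱ i⊏j (⊏⇒≤ j⊏k) })

  above : Fin d → ℕ
  above i = count (i ⊏_)

  above<d : ∀ i → above i < d
  above<d i = count< (i ⊏_) i (⊏-irrefl i)

  ⊏⇒above> : ∀ {i j} → T (i ⊏ j) → above j < above i
  ⊏⇒above> {i} {j} i⊏j = count-mono-< (j ⊏_) (i ⊏_) (λ k → ⊏-trans i⊏j) j i⊏j (⊏-irrefl j)

  ⊏⇒above≢0 : ∀ {i j} → T (i ⊏ j) → above i ≢ 0
  ⊏⇒above≢0 i⊏j above≡0 = n≮0 (subst (_ <_) above≡0 (⊏⇒above> i⊏j))

  maxAbove : (Fin d → ℕ) → Fin d → ℕ
  maxAbove h i = max (λ j → if i ⊏ j then h j else 0)

  maxAbove-cong : ∀ (g h : Fin d → ℕ) i → (∀ j → T (i ⊏ j) → g j ≡ h j) → maxAbove g i ≡ maxAbove h i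
  maxAbove-cong g h i eq = max-cong _ _ λ j → pointwise j (i ⊏ j) refl
    where
    pointwise : ∀ j b → i ⊏ j ≡ b → (if b then g j else 0) ≡ (if b then h j else 0)
    pointwise j true  i⊏j = eq j (subst T (sym i⊏j) _)
    pointwise j false _   = refl

  ≤-maxAbove : ∀ (h : Fin d → ℕ) {i j} → T (i ⊏ j) → h j ≤ maxAbove h i
  ≤-maxAbove h {i} {j} i⊏j = ≤-trans (pointwise (i ⊏ j) refl) (f≤max _ j)
    where
    pointwise : ∀ b → i ⊏ j ≡ b → h j ≤ (if b then h j else 0)
    pointwise true  _   = ≤-refl
    pointwise false eq = ⊥-elim (subst T eq i⊏j)

  maxAbove-lub : ∀ (h : Fin d → ℕ) i m → (∀ j → T (i ⊏ j) → h j ≤ m) → maxAbove h i ≤ m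
  maxAbove-lub h i m le = max-lub _ m λ j → pointwise j (i ⊏ j) refl
    where
    pointwise : ∀ j b → i ⊏ j ≡ b → (if b then h j else 0) ≤ m
    pointwise j true  i⊏j = le j (subst T (sym i⊏j) _)
    pointwise j false _   = z≤n

  maxAbove-top : ∀ (h : Fin d → ℕ) i → above i ≡ 0 → maxAbove h i ≡ 0
  maxAbove-top h i above≡0 = n≤0⇒n≡0 (maxAbove-lub h i 0 (λ j i⊏j → ⊥-elim (⊏⇒above≢0 i⊏j above≡0)))

  module _ (y : Fin d → ℕ) where

    -- iterate h ↦ y + maxAbove h; the k-th iterate is correct on all i with above i ≤ k
    heightUpTo : ℕ → Fin d → ℕ
    heightUpTo zero    i = y i
    heightUpTo (suc k) i = y i + maxAbove (heightUpTo k) i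

    height : Fin d → ℕ
    height = heightUpTo d

    private
      stable : ∀ k i → above i ≤ k → heightUpTo k i ≡ heightUpTo (suc k) i
      stable zero i le = sym (trans (cong (y i +_) (maxAbove-top _ i (n≤0⇒n≡0 le))) (+-identityʳ _))
      stable (suc k) i le = cong (y i +_) (maxAbove-cong _ _ i (λ j i⊏j → stable k j (≤-pred (≤-trans (⊏⇒above> i⊏j) le))))

      solution : (g : Fin d → ℕ) → (∀ i → g i ≡ y i + maxAbove g i) → ∀ k i → above i ≤ k → heightUpTo k i ≡ g i
      solution g g-rec zero i le = sym (trans (g-rec i) (trans (cong (y i +_) (maxAbove-top g i (n≤0⇒n≡0 le))) (+-identityʳ _)))
      solution g g-rec (suc k) i le =
        trans (cong (y i +_) (maxAbove-cong _ _ i (λ j i⊏j → solution g g-rec k j (≤-pred (≤-trans (⊏⇒above> i⊏j) le)))))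
              (sym (g-rec i))

    height-rec : ∀ i → height i ≡ y i + maxAbove height i
    height-rec i = stable d i (<⇒≤ (above<d i))

    height-unique : (g : Fin d → ℕ) → (∀ i → g i ≡ y i + maxAbove g i) → ∀ i → height i ≡ g i
    height-unique g g-rec i = solution g g-rec d i (<⇒≤ (above<d i))

    y≤height : ∀ i → y i ≤ height i
    y≤height i = ≤-trans (m≤m+n (y i) _) (≤-reflexive (sym (height-rec i)))

    maxAbove≤height : ∀ i → maxAbove height i ≤ height i
    maxAbove≤height i = ≤-trans (m≤n+m _ (y i)) (≤-reflexive (sym (height-rec i)))

    record Chain (i : Fin d) : Set where
      field
        member   : Fin d → Bool
        isChain  : ∀ a b → T (member a) → T (member b) → T (leq R a b) ⊎ T (leq R b a)
        ≥-bottom : ∀ a → T (member a) → T (leq R i a)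
        weight   : sumOver member y ≡ height i

    private
      singleton : ∀ i → maxAbove height i ≡ 0 → Chain i
      singleton i max≡0 = record
        { member   = _== i
        ; isChain  = λ a b a≡i b≡i → inj₁ (subst₂ (λ u v → T (leq R u v)) (sym (==⇒≡ a i a≡i)) (sym (==⇒≡ b i b≡i)) (R.refl i))
        ; ≥-bottom = λ a a≡i → subst (λ u → T (leq R i u)) (sym (==⇒≡ a i a≡i)) (R.refl i)
        ; weight   = trans (sumOver-singleton y i) (sym (trans (height-rec i) (trans (cong (y i +_) max≡0) (+-identityʳ _))))
        }

      extend : ∀ {i j} → T (i ⊏ j) → maxAbove height i ≡ height j → Chain j → Chain i
      extend {i} {j} i⊏j max≡ C = record
        { member   = λ a → (a == i) ∨ C.member a
        ; isChain  = isChain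
        ; ≥-bottom = ≥-bottom
        ; weight   = trans (sumOver-insert C.member y i i∉C)
                       (trans (cong (y i +_) C.weight) (sym (trans (height-rec i) (cong (y i +_) max≡))))
        }
        where
        module C = Chain C
        i∉C : ¬ T (C.member i)
        i∉C i∈C = ⊏⇒≱ i⊏j (C.≥-bottom i i∈C)
        ≥-bottom : ∀ a → T ((a == i) ∨ C.member a) → T (leq R i a)
        ≥-bottom a a∈ with to T-∨ a∈
        ... | inj₁ a≡i = subst (λ u → T (leq R i u)) (sym (==⇒≡ a i a≡i)) (R.refl i)
        ... | inj₂ a∈C = R.trans i j a (⊏⇒≤ i⊏j) (C.≥-bottom a a∈C)
        isChain : ∀ a b → T ((a == i) ∨ C.member a) → T ((b == i) ∨ C.member b) → T (leq R a b) ⊎ T (leq R b a)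
        isChain a b a∈ b∈ with to T-∨ a∈ | to T-∨ b∈
        ... | inj₁ a≡i | _ = inj₁ (subst (λ u → T (leq R u b)) (sym (==⇒≡ a i a≡i)) (≥-bottom b b∈))
        ... | inj₂ _ | inj₁ b≡i = inj₂ (subst (λ u → T (leq R u a)) (sym (==⇒≡ b i b≡i)) (≥-bottom a a∈))
        ... | inj₂ a∈C | inj₂ b∈C = C.isChain a b a∈C b∈C

      chainUpTo : ∀ k i → above i ≤ k → Chain i
      chainUpTo k i le with max≡0⊎attained (λ j → if i ⊏ j then height j else 0)
      ... | inj₁ max≡0 = singleton i max≡0
      ... | inj₂ (j , max≡) with i ⊏ j in i⊏j
      ...   | false = singleton i max≡
      ...   | true with k
      ...     | zero  = ⊥-elim (⊏⇒above≢0 (subst T (sym i⊏j) _) (n≤0⇒n≡0 le))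
      ...     | suc k = extend (subst T (sym i⊏j) _) max≡
                          (chainUpTo k j (≤-pred (≤-trans (⊏⇒above> (subst T (sym i⊏j) _)) le)))

    heaviestChain : ∀ i → Chain i
    heaviestChain i = chainUpTo d i (<⇒≤ (above<d i))

module OrdinalSum {d : ℕ} (P Q : Defs.FinPoset d) where

  open import Data.Fin using (Fin)
  open import Data.Fin.Subset using (Subset)
  open import Data.Bool using (true; false; T)
  open import Data.Empty using (⊥-elim)
  open import Relation.Nullary using (¬_)
  open import Relation.Binary.PropositionalEquality using (_≡_)
  open import Defs using (FinPoset; leq; leqΔ; inW)
  private
    module P = FinPoset P
    module Q = FinPoset Q

  module _ (W : Subset d) where

    private
      _≤Δ_ : Fin d → Fin d → Set
      i ≤Δ j = T (leqΔ P Q W i j)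

      Δ-refl : ∀ i → i ≤Δ i
      Δ-refl i with inW W i
      ... | true  = P.refl i
      ... | false = Q.refl i

      Δ-antisym : ∀ i j → i ≤Δ j → j ≤Δ i → i ≡ j
      Δ-antisym i j i≤j j≤i with inW W i | inW W j
      ... | true  | true  = P.antisym i j i≤j j≤i
      ... | false | false = Q.antisym i j i≤j j≤i
      ... | true  | false = ⊥-elim j≤i
      ... | false | true  = ⊥-elim i≤j

      Δ-trans : ∀ i j k → i ≤Δ j → j ≤Δ k → i ≤Δ k
      Δ-trans i j k i≤j j≤k with inW W i | inW W j | inW W k
      ... | true  | true  | true  = P.trans i j k i≤j j≤k
      ... | false | false | false = Q.trans i j k i≤j j≤k
      ... | true  | true  | false = _
      ... | true  | false | true  = ⊥-elim j≤k
      ... | true  | false | false = _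
      ... | false | true  | _     = ⊥-elim i≤j
      ... | false | false | true  = ⊥-elim j≤k

    Δ : FinPoset d
    Δ = record { leq = leqΔ P Q W ; refl = Δ-refl ; antisym = Δ-antisym ; trans = Δ-trans }

    ≤Δ⇒≤P : ∀ i j → T (inW W i) → T (inW W j) → T (leqΔ P Q W i j) → T (leq P i j)
    ≤Δ⇒≤P i j i∈W j∈W i≤j with inW W i | inW W j
    ... | true | true = i≤j

    ≤P⇒≤Δ : ∀ i j → T (inW W i) → T (inW W j) → T (leq P i j) → T (leqΔ P Q W i j)
    ≤P⇒≤Δ i j i∈W j∈W i≤j with inW W i | inW W j
    ... | true | true = i≤j

    ≤Δ⇒≤Q : ∀ i j → ¬ T (inW W i) → ¬ T (inW W j) → T (leqΔ P Q W i j) → T (leq Q i j)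
    ≤Δ⇒≤Q i j i∉W j∉W i≤j with inW W i | inW W j
    ... | false | false = i≤j
    ... | true  | _     = ⊥-elim (i∉W _)
    ... | false | true  = ⊥-elim (j∉W _)

    ≤Q⇒≤Δ : ∀ i j → ¬ T (inW W i) → ¬ T (inW W j) → T (leq Q i j) → T (leqΔ P Q W i j)
    ≤Q⇒≤Δ i j i∉W j∉W i≤j with inW W i | inW W j
    ... | false | false = i≤j
    ... | true  | _     = ⊥-elim (i∉W _)
    ... | false | true  = ⊥-elim (j∉W _)

    W≤Δ∁W : ∀ i j → T (inW W i) → ¬ T (inW W j) → T (leqΔ P Q W i j)
    W≤Δ∁W i j i∈W j∉W with inW W i | inW W j
    ... | true  | false = _
    ... | false | _     = ⊥-elim i∈W
    ... | true  | true  = ⊥-elim (j∉W _)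

module IntegerEmbedding where

  open import Data.Nat as ℕ using (ℕ; zero; suc; z≤n)
  import Data.Nat.Properties as ℕP
  open import Data.Integer as ℤ using (ℤ; +_)
  import Data.Integer.Properties as ℤP
  open import Data.Rational as ℚ using (ℚ; 1ℚ; _+_; _*_; -_; _≤_; fromℚᵘ)
  import Data.Rational.Properties as ℚP
  open import Data.Rational.Unnormalised as ℚᵘ using (ℚᵘ; mkℚᵘ; *≡*; *≤*)
  import Data.Rational.Unnormalised.Properties as ℚᵘP
  open import Algebra.Bundles using (CommutativeRing)
  import Algebra.Properties.Semiring.Sum
  open import Data.Fin using (Fin; zero; suc)
  open import Relation.Binary.PropositionalEquality
  open import Data.Integer.Solver using (module +-*-Solver)
  open +-*-Solver using (solve; _:+_; _:*_; _:=_; con)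

  module ℤΣ = Algebra.Properties.Semiring.Sum ℤP.+-*-semiring
  module ℚΣ = Algebra.Properties.Semiring.Sum (CommutativeRing.semiring ℚP.+-*-commutativeRing)

  fromℚᵘ-homo-+ : ∀ p q → fromℚᵘ (p ℚᵘ.+ q) ≡ fromℚᵘ p + fromℚᵘ q
  fromℚᵘ-homo-+ p q = ℚP.toℚᵘ-injective (ℚᵘP.≃-trans (ℚP.toℚᵘ-fromℚᵘ (p ℚᵘ.+ q))
    (ℚᵘP.≃-trans (ℚᵘP.+-cong (ℚᵘP.≃-sym (ℚP.toℚᵘ-fromℚᵘ p)) (ℚᵘP.≃-sym (ℚP.toℚᵘ-fromℚᵘ q)))
                 (ℚᵘP.≃-sym (ℚP.toℚᵘ-homo-+ (fromℚᵘ p) (fromℚᵘ q)))))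

  fromℚᵘ-homo-* : ∀ p q → fromℚᵘ (p ℚᵘ.* q) ≡ fromℚᵘ p * fromℚᵘ q
  fromℚᵘ-homo-* p q = ℚP.toℚᵘ-injective (ℚᵘP.≃-trans (ℚP.toℚᵘ-fromℚᵘ (p ℚᵘ.* q))
    (ℚᵘP.≃-trans (ℚᵘP.*-cong (ℚᵘP.≃-sym (ℚP.toℚᵘ-fromℚᵘ p)) (ℚᵘP.≃-sym (ℚP.toℚᵘ-fromℚᵘ q)))
                 (ℚᵘP.≃-sym (ℚP.toℚᵘ-homo-* (fromℚᵘ p) (fromℚᵘ q)))))

  fromℚᵘ-homo‿- : ∀ p → fromℚᵘ (ℚᵘ.- p) ≡ - fromℚᵘ p
  fromℚᵘ-homo‿- p = ℚP.toℚᵘ-injective (ℚᵘP.≃-trans (ℚP.toℚᵘ-fromℚᵘ (ℚᵘ.- p))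
    (ℚᵘP.≃-trans (ℚᵘP.-‿cong (ℚᵘP.≃-sym (ℚP.toℚᵘ-fromℚᵘ p))) (ℚᵘP.≃-sym (ℚP.toℚᵘ-homo‿- (fromℚᵘ p)))))

  fromℤ : ℤ → ℚ
  fromℤ a = a ℚ./ 1

  fromℤ-homo-+ : ∀ a b → fromℤ (a ℤ.+ b) ≡ fromℤ a + fromℤ b
  fromℤ-homo-+ a b = trans (ℚP.fromℚᵘ-cong {mkℚᵘ (a ℤ.+ b) 0} {mkℚᵘ a 0 ℚᵘ.+ mkℚᵘ b 0}
      (*≡* (solve 2 (λ a b → (a :+ b) :* con (+ 1) := (a :* con (+ 1) :+ b :* con (+ 1)) :* con (+ 1)) refl a b)))
    (fromℚᵘ-homo-+ (mkℚᵘ a 0) (mkℚᵘ b 0))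

  fromℤ-homo-* : ∀ a b → fromℤ (a ℤ.* b) ≡ fromℤ a * fromℤ b
  fromℤ-homo-* a b = fromℚᵘ-homo-* (mkℚᵘ a 0) (mkℚᵘ b 0)

  fromℤ-homo‿- : ∀ a → fromℤ (ℤ.- a) ≡ - fromℤ a
  fromℤ-homo‿- a = fromℚᵘ-homo‿- (mkℚᵘ a 0)

  fromℤ-homo-sum : ∀ {d} (f : Fin d → ℤ) → fromℤ (ℤΣ.sum f) ≡ ℚΣ.sum (λ i → fromℤ (f i))
  fromℤ-homo-sum {zero} f = refl
  fromℤ-homo-sum {suc d} f = trans (fromℤ-homo-+ (f zero) _) (cong (λ s → fromℤ (f zero) + s) (fromℤ-homo-sum (λ i → f (suc i))))

  fromℤ-mono-≤ : ∀ {a b} → a ℤ.≤ b → fromℤ a ≤ fromℤ b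
  fromℤ-mono-≤ {a} {b} a≤b = ℚP.toℚᵘ-cancel-≤ (ℚᵘP.≤-respˡ-≃ (ℚᵘP.≃-sym (ℚP.toℚᵘ-fromℚᵘ (mkℚᵘ a 0)))
    (ℚᵘP.≤-respʳ-≃ (ℚᵘP.≃-sym (ℚP.toℚᵘ-fromℚᵘ (mkℚᵘ b 0))) (*≤* (ℤP.*-monoʳ-≤-nonNeg (+ 1) a≤b))))

  fromℤ-cancel-≤ : ∀ {a b} → fromℤ a ≤ fromℤ b → a ℤ.≤ b
  fromℤ-cancel-≤ {a} {b} a≤b with ℚᵘP.≤-respˡ-≃ (ℚP.toℚᵘ-fromℚᵘ (mkℚᵘ a 0))
                                   (ℚᵘP.≤-respʳ-≃ (ℚP.toℚᵘ-fromℚᵘ (mkℚᵘ b 0)) (ℚP.toℚᵘ-mono-≤ a≤b))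
  ... | *≤* a*1≤b*1 = subst₂ ℤ._≤_ (ℤP.*-identityʳ a) (ℤP.*-identityʳ b) a*1≤b*1

  /-as-* : ∀ z m → z ℚ./ suc m ≡ fromℤ z * (+ 1 ℚ./ suc m)
  /-as-* z m = trans (ℚP.fromℚᵘ-cong {mkℚᵘ z m} {mkℚᵘ z 0 ℚᵘ.* mkℚᵘ (+ 1) m}
      (*≡* (trans (cong (λ k → z ℤ.* + k) (ℕP.*-identityˡ (suc m)))
                  (solve 2 (λ z k → z :* k := (z :* con (+ 1)) :* k) refl z (+ suc m)))))
    (fromℚᵘ-homo-* (mkℚᵘ z 0) (mkℚᵘ (+ 1) m))

  fromℤ-*-inverse : ∀ m → fromℤ (+ suc m) * (+ 1 ℚ./ suc m) ≡ 1ℚ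
  fromℤ-*-inverse m = trans (sym (fromℚᵘ-homo-* (mkℚᵘ (+ suc m) 0) (mkℚᵘ (+ 1) m)))
    (ℚP.fromℚᵘ-cong {mkℚᵘ (+ suc m) 0 ℚᵘ.* mkℚᵘ (+ 1) m} {mkℚᵘ (+ 1) 0}
      (*≡* (trans (solve 1 (λ k → (k :* con (+ 1)) :* con (+ 1) := con (+ 1) :* k) refl (+ suc m))
                  (cong (λ k → + 1 ℤ.* + k) (sym (ℕP.*-identityˡ (suc m)))))))

  ≤1⇒≤n : ∀ k m → fromℤ (+ k) * (+ 1 ℚ./ suc m) ≤ 1ℚ → k ℕ.≤ suc m
  ≤1⇒≤n k m k/n≤1 = ℤP.drop‿+≤+ (fromℤ-cancel-≤ (begin
    fromℤ (+ k)                        ≡⟨ sym (ℚP.*-identityʳ _) ⟩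
    fromℤ (+ k) * 1ℚ                   ≡⟨ cong (fromℤ (+ k) *_) (sym (trans (ℚP.*-comm w _) (fromℤ-*-inverse m))) ⟩
    fromℤ (+ k) * (w * fromℤ (+ suc m)) ≡⟨ sym (ℚP.*-assoc (fromℤ (+ k)) w _) ⟩
    fromℤ (+ k) * w * fromℤ (+ suc m)   ≤⟨ ℚP.*-monoʳ-≤-nonNeg (fromℤ (+ suc m)) {{n≥0}} k/n≤1 ⟩
    1ℚ * fromℤ (+ suc m)                ≡⟨ ℚP.*-identityˡ _ ⟩
    fromℤ (+ suc m)                     ∎))
    where
    open ℚP.≤-Reasoning
    w = + 1 ℚ./ suc m
    n≥0 : ℚ.NonNegative (fromℤ (+ suc m))
    n≥0 = ℚ.nonNegative (fromℤ-mono-≤ {+ 0} {+ suc m} (ℤ.+≤+ z≤n))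

  +-homo-sum : ∀ {d} (f : Fin d → ℕ) → ℤΣ.sum (λ a → + f a) ≡ + Folds.sum f
  +-homo-sum {zero} f = refl
  +-homo-sum {suc d} f = cong (λ s → + f zero ℤ.+ s) (+-homo-sum (λ a → f (suc a)))

  ℤΣ-mono-≤ : ∀ {d} (f g : Fin d → ℤ) → (∀ a → f a ℤ.≤ g a) → ℤΣ.sum f ℤ.≤ ℤΣ.sum g
  ℤΣ-mono-≤ {zero} f g f≤g = ℤP.≤-refl
  ℤΣ-mono-≤ {suc d} f g f≤g = ℤP.+-mono-≤ (f≤g zero) (ℤΣ-mono-≤ (λ a → f (suc a)) (λ a → g (suc a)) (λ a → f≤g (suc a)))

module ConvexHull {d : ℕ} where

  open import Data.Nat as ℕ using (ℕ; zero; suc)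
  open import Data.Integer as ℤ using (ℤ; +_)
  import Data.Integer.Properties as ℤP
  open import Data.Rational as ℚ using (ℚ; 0ℚ; 1ℚ; _+_; _*_; -_; _≤_)
  import Data.Rational.Properties as ℚP
  open import Data.Rational.Solver using (module +-*-Solver)
  open import Data.Fin using (Fin)
  open import Data.Fin.Subset using (Subset)
  open import Data.Vec using (Vec; lookup)
  open import Data.Bool using (true; false; if_then_else_)
  open import Data.List using (List; []; _∷_; foldr)
  open import Data.List.Relation.Unary.All using (All; []; _∷_)
  open import Data.Product using (_×_; _,_)
  open import Relation.Binary.PropositionalEquality
  open import Defs using (Point; Conv; combCoord; weightSum; ρ)
  open IntegerEmbedding
  open Folds using (indicator)
  open +-*-Solver using (solve; _:+_; _:*_; _:=_; :-_; con)

  ⟪_,_⟫ : (Fin d → ℤ) → Point d → ℚ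
  ⟪ c , x ⟫ = ℚΣ.sum {d} (λ i → fromℤ (c i) * x i)

  ⟪⟫-combCoord : ∀ c (ws : List (ℚ × Point d)) →
    ⟪ c , combCoord ws ⟫ ≡ foldr (λ { (l , v) s → l * ⟪ c , v ⟫ + s }) 0ℚ ws
  ⟪⟫-combCoord c [] = trans (ℚΣ.sum-cong-≗ {d} (λ i → ℚP.*-zeroʳ (fromℤ (c i)))) (ℚΣ.sum-replicate-zero d)
  ⟪⟫-combCoord c ((l , v) ∷ ws) = begin
    ℚΣ.sum (λ i → fromℤ (c i) * (l * v i + combCoord ws i))
      ≡⟨ ℚΣ.sum-cong-≗ {d} (λ i → solve 4 (λ a b e f → a :* (b :* e :+ f) := b :* (a :* e) :+ a :* f) refl (fromℤ (c i)) l (v i) (combCoord ws i)) ⟩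
    ℚΣ.sum (λ i → l * (fromℤ (c i) * v i) + fromℤ (c i) * combCoord ws i)
      ≡⟨ ℚΣ.∑-distrib-+ {d} _ _ ⟩
    ℚΣ.sum (λ i → l * (fromℤ (c i) * v i)) + ⟪ c , combCoord ws ⟫
      ≡⟨ cong₂ _+_ (sym (ℚΣ.*-distribˡ-sum {d} l _)) (⟪⟫-combCoord c ws) ⟩
    l * ⟪ c , v ⟫ + foldr (λ { (l , v) s → l * ⟪ c , v ⟫ + s }) 0ℚ ws ∎
    where open ≡-Reasoning

  ⟪⟫≤1-Conv : ∀ (S : Point d → Set) c → (∀ v → S v → ⟪ c , v ⟫ ≤ 1ℚ) → ∀ x → Conv S x → ⟪ c , x ⟫ ≤ 1ℚ
  ⟪⟫≤1-Conv S c S≤1 x (ws , ws∈S , ∑ws≡1 , ws↦x) =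
    ℚP.≤-trans (ℚP.≤-reflexive (trans (ℚΣ.sum-cong-≗ {d} (λ i → cong (fromℤ (c i) *_) (sym (ws↦x i)))) (⟪⟫-combCoord c ws)))
      (ℚP.≤-trans (go ws ws∈S) (ℚP.≤-reflexive ∑ws≡1))
    where
    go : ∀ ws → All (λ { (l , v) → (0ℚ ≤ l) × S v }) ws →
         foldr (λ { (l , v) s → l * ⟪ c , v ⟫ + s }) 0ℚ ws ≤ weightSum ws
    go [] [] = ℚP.≤-refl
    go ((l , v) ∷ ws) ((0≤l , v∈S) ∷ ws∈S) = ℚP.+-mono-≤
      (ℚP.≤-trans (ℚP.*-monoˡ-≤-nonNeg l {{ℚ.nonNegative 0≤l}} (S≤1 v v∈S)) (ℚP.≤-reflexive (ℚP.*-identityʳ l)))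
      (go ws ws∈S)

  ⟪⟫-neg : ∀ c v → ⟪ c , v ⟫ ≡ ⟪ (λ a → ℤ.- c a) , (λ i → - v i) ⟫
  ⟪⟫-neg c v = ℚΣ.sum-cong-≗ {d} λ a →
    trans (solve 2 (λ p q → p :* q := (:- p) :* (:- q)) refl (fromℤ (c a)) (v a)) (cong (_* (- v a)) (sym (fromℤ-homo‿- (c a))))

  ⟪⟫-ρ : ∀ c (A : Subset d) → ⟪ c , ρ A ⟫ ≡ fromℤ (ℤΣ.sum (λ a → c a ℤ.* + indicator (lookup A a)))
  ⟪⟫-ρ c A = trans (ℚΣ.sum-cong-≗ {d} (λ a → pointwise (c a) (lookup A a))) (sym (fromℤ-homo-sum {d} _))
    where
    pointwise : ∀ k b → fromℤ k * (if b then 1ℚ else 0ℚ) ≡ fromℤ (k ℤ.* + indicator b)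
    pointwise k true  = trans (ℚP.*-identityʳ (fromℤ k)) (cong fromℤ (sym (ℤP.*-identityʳ k)))
    pointwise k false = trans (ℚP.*-zeroʳ (fromℤ k)) (cong fromℤ (sym (ℤP.*-zeroʳ k)))

  ⟪⟫-grid : ∀ c (z : Vec ℤ d) m →
    ⟪ c , (λ a → lookup z a ℚ./ suc m) ⟫ ≡ fromℤ (ℤΣ.sum (λ a → c a ℤ.* lookup z a)) * (+ 1 ℚ./ suc m)
  ⟪⟫-grid c z m = begin
    ℚΣ.sum (λ a → fromℤ (c a) * (lookup z a ℚ./ suc m))
      ≡⟨ ℚΣ.sum-cong-≗ {d} pointwise ⟩
    ℚΣ.sum (λ a → fromℤ (c a ℤ.* lookup z a) * w)
      ≡⟨ sym (ℚΣ.*-distribʳ-sum {d} w _) ⟩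
    ℚΣ.sum (λ a → fromℤ (c a ℤ.* lookup z a)) * w
      ≡⟨ cong (_* w) (sym (fromℤ-homo-sum {d} _)) ⟩
    fromℤ (ℤΣ.sum (λ a → c a ℤ.* lookup z a)) * w ∎
    where
    open ≡-Reasoning
    w = + 1 ℚ./ suc m
    pointwise : ∀ a → fromℤ (c a) * (lookup z a ℚ./ suc m) ≡ fromℤ (c a ℤ.* lookup z a) * w
    pointwise a = trans (cong (fromℤ (c a) *_) (/-as-* (lookup z a) m))
      (trans (sym (ℚP.*-assoc (fromℤ (c a)) (fromℤ (lookup z a)) w)) (cong (_* w) (sym (fromℤ-homo-* (c a) (lookup z a)))))

  Conv-point : ∀ (S : Point d → Set) {u x : Point d} → S u → (∀ i → u i ≡ x i) → Conv S x
  Conv-point S {u} u∈S u≗x =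
    (1ℚ , u) ∷ [] , (ℚP.nonNegative⁻¹ 1ℚ , u∈S) ∷ [] , ℚP.+-identityʳ 1ℚ ,
    λ i → trans (ℚP.+-identityʳ _) (trans (ℚP.*-identityˡ _) (u≗x i))

  uniformCombination : ℚ → (ℕ → Point d) → ℕ → List (ℚ × Point d)
  uniformCombination w v zero    = []
  uniformCombination w v (suc t) = (w , v (suc t)) ∷ uniformCombination w v t

  weightSum-uniform : ∀ w v t → weightSum (uniformCombination w v t) ≡ fromℤ (+ t) * w
  weightSum-uniform w v zero = sym (ℚP.*-zeroˡ w)
  weightSum-uniform w v (suc t) = begin
    w + weightSum (uniformCombination w v t) ≡⟨ cong (λ s → w + s) (weightSum-uniform w v t) ⟩
    w + fromℤ (+ t) * w                      ≡⟨ solve 2 (λ w t → w :+ t :* w := (con 1ℚ :+ t) :* w) refl w (fromℤ (+ t)) ⟩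
    (1ℚ + fromℤ (+ t)) * w                   ≡⟨ cong (_* w) (sym (fromℤ-homo-+ (+ 1) (+ t))) ⟩
    fromℤ (+ suc t) * w                      ∎
    where open ≡-Reasoning

  uniformCombination-All : ∀ (S : Point d → Set) {w} v t → 0ℚ ≤ w → (∀ s → S (v s)) →
    All (λ { (l , u) → (0ℚ ≤ l) × S u }) (uniformCombination w v t)
  uniformCombination-All S v zero    0≤w v∈S = []
  uniformCombination-All S v (suc t) 0≤w v∈S = (0≤w , v∈S (suc t)) ∷ uniformCombination-All S v t 0≤w v∈S

module Signs where

  open import Data.Nat as ℕ using (zero; suc)
  open import Data.Integer as ℤ using (ℤ; +_; -[1+_]; ∣_∣)
  import Data.Integer.Properties as ℤP
  open import Data.Bool using (Bool; true; false)
  open import Relation.Binary.PropositionalEquality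

  isPositive : ℤ → Bool
  isPositive (+ suc _) = true
  isPositive _         = false

  sgn : Bool → ℤ
  sgn true  = + 1
  sgn false = -[1+ 0 ]

  sgn-isPositive-* : ∀ z → sgn (isPositive z) ℤ.* z ≡ + ∣ z ∣
  sgn-isPositive-* (+ zero)  = refl
  sgn-isPositive-* (+ suc n) = ℤP.*-identityˡ (+ suc n)
  sgn-isPositive-* -[1+ n ]  = ℤP.-1*i≡-i -[1+ n ]

  sgn-isPositive-*-abs : ∀ z → sgn (isPositive z) ℤ.* + ∣ z ∣ ≡ z
  sgn-isPositive-*-abs (+ zero)  = refl
  sgn-isPositive-*-abs (+ suc n) = ℤP.*-identityˡ (+ suc n)
  sgn-isPositive-*-abs -[1+ n ]  = ℤP.-1*i≡-i (+ suc n)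

  isPositive-sgn-* : ∀ b k → isPositive (sgn b ℤ.* + suc k) ≡ b
  isPositive-sgn-* true  k = refl
  isPositive-sgn-* false k = refl

  abs-sgn-* : ∀ b k → ∣ sgn b ℤ.* + k ∣ ≡ k
  abs-sgn-* true  k = cong ∣_∣ (ℤP.*-identityˡ (+ k))
  abs-sgn-* false k = trans (cong ∣_∣ (ℤP.-1*i≡-i (+ k))) (ℤP.∣-i∣≡∣i∣ (+ k))

module LatticePoints {d : ℕ} (P Q : Defs.FinPoset d) where

  open import Data.Nat as ℕ using (ℕ; zero; suc; z≤n; _≤_)
  import Data.Nat.Properties as ℕP
  open import Data.Integer as ℤ using (ℤ; +_; ∣_∣)
  import Data.Integer.Properties as ℤP
  open import Data.Rational as ℚ using (ℚ; 0ℚ; 1ℚ)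
  import Data.Rational.Properties as ℚP
  open import Data.Fin using (Fin; _≟_)
  open import Data.Fin.Properties using (any?)
  open import Data.Fin.Subset using (Subset)
  open import Data.Vec using (Vec; lookup; tabulate)
  import Data.Vec.Properties as VecP
  open import Data.Bool using (Bool; true; false; T; if_then_else_; _∧_; not)
  open import Data.Bool.Properties using (T-∧; T?)
  open import Data.Sum using (_⊎_; inj₁; inj₂)
  open import Data.Product using (_,_; proj₁; proj₂)
  open import Data.Empty using (⊥-elim)
  open import Function using (Equivalence; _∘_; id)
  open import Relation.Nullary using (¬_; yes; no)
  open import Relation.Binary.PropositionalEquality
  open import Defs using (FinPoset; Point; Gamma; ChainPolytope; neg; IsAntichain; ρ; leqΔ; combCoord)
  open import Data.Rational.Solver using (module +-*-Solver)
  open +-*-Solver using (solve; _:+_; _:*_; _:=_)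
  open Folds using (indicator; count≤1; countUpTo; countUpTo-interval)
  open OrdinalSum P Q
  open Signs
  open IntegerEmbedding
  open ConvexHull
  open Equivalence using (to; from)

  positives : Vec ℤ d → Subset d
  positives z = tabulate (λ i → isPositive (lookup z i))

  lookup-positives : ∀ z a → lookup (positives z) a ≡ isPositive (lookup z a)
  lookup-positives z a = VecP.lookup∘tabulate _ a

  magnitudes : Vec ℤ d → Fin d → ℕ
  magnitudes z i = ∣ lookup z i ∣

  height : Vec ℤ d → Fin d → ℕ
  height z = Height.height (Δ (positives z)) (magnitudes z)

  Bounded : ℕ → Vec ℤ d → Set
  Bounded n z = ∀ i → height z i ≤ n

  -- z / m is the grid point z/(m+1)
  _/_ : Vec ℤ d → ℕ → Point d
  (z / m) a = lookup z a ℚ./ suc m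

  module _ (z : Vec ℤ d) (m : ℕ) where

    private
      W = positives z
      open Height (Δ W) using (Chain; heaviestChain)

      chain∩antichain : ∀ (R : FinPoset d) (side : Bool → Bool) →
        (∀ a b → T (side (lookup W a)) → T (side (lookup W b)) → T (leqΔ P Q W a b) → T (Defs.leq R a b)) →
        ∀ {i} (C : Chain (magnitudes z) i) A → IsAntichain R A →
        ∀ a b → T (Chain.member C a ∧ side (lookup W a) ∧ lookup A a) →
                T (Chain.member C b ∧ side (lookup W b) ∧ lookup A b) → a ≡ b
      chain∩antichain R side ≤Δ⇒≤R C A anti a b a∈ b∈ with a ≟ b
      ... | yes a≡b = a≡b
      ... | no a≢b with to T-∧ a∈ | to T-∧ b∈
      ...   | a∈C , a∈ʷA | b∈C , b∈ʷA with to T-∧ a∈ʷA | to T-∧ b∈ʷA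
      ...     | sa , a∈A | sb , b∈A with Chain.isChain C a b a∈C b∈C
      ...       | inj₁ a≤b = ⊥-elim (anti a b a∈A b∈A a≢b (≤Δ⇒≤R a b sa sb a≤b))
      ...       | inj₂ b≤a = ⊥-elim (anti b a b∈A a∈A (a≢b ∘ sym) (≤Δ⇒≤R b a sb sa b≤a))

      T-not⇒¬T : ∀ {b} → T (not b) → ¬ T b
      T-not⇒¬T {false} _ ()

      signedIndicator-≤ : ∀ s v b → (if s then sgn v else + 0) ℤ.* + indicator b ℤ.≤ + indicator (s ∧ v ∧ b)
      signedIndicator-≤ false v     b     = ℤ.+≤+ z≤n
      signedIndicator-≤ true  true  true  = ℤP.≤-refl
      signedIndicator-≤ true  true  false = ℤP.≤-refl
      signedIndicator-≤ true  false true  = ℤ.-≤+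
      signedIndicator-≤ true  false false = ℤP.≤-refl

      module _ {i} (C : Chain (magnitudes z) i) where

        coefficient : (Bool → Bool) → Fin d → ℤ
        coefficient side a = if Chain.member C a then sgn (side (lookup W a)) else + 0

        ⟪coefficient,antichain⟫≤1 : ∀ (R : FinPoset d) side →
          (∀ a b → T (side (lookup W a)) → T (side (lookup W b)) → T (leqΔ P Q W a b) → T (Defs.leq R a b)) →
          ∀ A → IsAntichain R A → ⟪ coefficient side , ρ A ⟫ ℚ.≤ 1ℚ
        ⟪coefficient,antichain⟫≤1 R side ≤Δ⇒≤R A anti = begin
          ⟪ coefficient side , ρ A ⟫
            ≡⟨ ⟪⟫-ρ (coefficient side) A ⟩
          fromℤ (ℤΣ.sum (λ a → coefficient side a ℤ.* + indicator (lookup A a)))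
            ≤⟨ fromℤ-mono-≤ (ℤΣ-mono-≤ {d} _ _ (λ a → signedIndicator-≤ (Chain.member C a) (side (lookup W a)) (lookup A a))) ⟩
          fromℤ (ℤΣ.sum (λ a → + indicator (Chain.member C a ∧ side (lookup W a) ∧ lookup A a)))
            ≤⟨ fromℤ-mono-≤ (ℤP.≤-trans (ℤP.≤-reflexive (+-homo-sum {d} _)) (ℤ.+≤+ (count≤1 {d} _ (chain∩antichain R side ≤Δ⇒≤R C A anti)))) ⟩
          1ℚ ∎
          where open ℚP.≤-Reasoning

        ⟪coefficient,Γ⟫≤1 : ∀ v → ChainPolytope P v ⊎ neg (ChainPolytope Q) v → ⟪ coefficient id , v ⟫ ℚ.≤ 1ℚ
        ⟪coefficient,Γ⟫≤1 v (inj₁ v∈CP) = ⟪⟫≤1-Conv _ (coefficient id)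
          (λ { u (A , anti , refl) → ⟪coefficient,antichain⟫≤1 P id (λ a b → ≤Δ⇒≤P W a b) A anti }) v v∈CP
        ⟪coefficient,Γ⟫≤1 v (inj₂ -v∈CQ) = ℚP.≤-trans (ℚP.≤-reflexive (trans (⟪⟫-neg (coefficient id) v) (ℚΣ.sum-cong-≗ {d} flip-sign)))
          (⟪⟫≤1-Conv _ (coefficient not)
            (λ { u (A , anti , refl) → ⟪coefficient,antichain⟫≤1 Q not (λ a b a∉W b∉W → ≤Δ⇒≤Q W a b (T-not⇒¬T a∉W) (T-not⇒¬T b∉W)) A anti })
            _ -v∈CQ)
          where
          flip-sign : ∀ a → fromℤ (ℤ.- coefficient id a) ℚ.* (ℚ.- v a) ≡ fromℤ (coefficient not a) ℚ.* (ℚ.- v a)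
          flip-sign a with Chain.member C a | lookup W a
          ... | true  | true  = refl
          ... | true  | false = refl
          ... | false | _     = refl

        ⟪coefficient,z⟫≡height : ⟪ coefficient id , z / m ⟫ ≡ fromℤ (+ height z i) ℚ.* (+ 1 ℚ./ suc m)
        ⟪coefficient,z⟫≡height = trans (⟪⟫-grid (coefficient id) z m) (cong (λ s → fromℤ s ℚ.* (+ 1 ℚ./ suc m))
          (trans (ℤΣ.sum-cong-≗ {d} pointwise) (trans (+-homo-sum {d} _) (cong +_ (Chain.weight C)))))
          where
          pointwise : ∀ a → coefficient id a ℤ.* lookup z a ≡ + (if Chain.member C a then magnitudes z a else 0)
          pointwise a with Chain.member C a
          ... | true  = trans (cong (λ b → sgn b ℤ.* lookup z a) (lookup-positives z a)) (sgn-isPositive-* (lookup z a))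
          ... | false = ℤP.*-zeroˡ (lookup z a)

    Γ⇒Bounded : Gamma P Q (z / m) → Bounded (suc m) z
    Γ⇒Bounded z∈Γ i = ≤1⇒≤n (height z i) m (begin
      fromℤ (+ height z i) ℚ.* (+ 1 ℚ./ suc m) ≡⟨ sym (⟪coefficient,z⟫≡height C) ⟩
      ⟪ coefficient C id , z / m ⟫             ≤⟨ ⟪⟫≤1-Conv _ (coefficient C id) (⟪coefficient,Γ⟫≤1 C) _ z∈Γ ⟩
      1ℚ                                       ∎)
      where
      open ℚP.≤-Reasoning
      C = heaviestChain (magnitudes z) i

    private
      module ΔW = Height (Δ W)
      h = height z
      w = + 1 ℚ./ suc m

      layer : ℕ → Fin d → Bool
      layer t a = (ΔW.maxAbove h a ℕ.<ᵇ t) ∧ (t ℕ.≤ᵇ h a)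

      layer-antichain : ∀ t a b → T (layer t a) → T (layer t b) → a ≢ b → ¬ T (leqΔ P Q W a b)
      layer-antichain t a b a∈ b∈ a≢b a≤b with to T-∧ a∈ | to T-∧ b∈
      ... | max<t , _ | _ , t≤h = ℕP.<-irrefl refl (begin-strict
        ΔW.maxAbove h a <⟨ ℕP.<ᵇ⇒< _ t max<t ⟩
        t               ≤⟨ ℕP.≤ᵇ⇒≤ t _ t≤h ⟩
        h b             ≤⟨ ΔW.≤-maxAbove h (ΔW.≤∧≢⇒⊏ a≤b a≢b) ⟩
        ΔW.maxAbove h a ∎)
        where open ℕP.≤-Reasoning

      indicator-positive : ∀ l s → (T l → T s) → (if l then 1ℚ else 0ℚ) ≡ fromℤ (sgn s ℤ.* + indicator l)
      indicator-positive true  true  _   = refl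
      indicator-positive true  false l⇒s = ⊥-elim (l⇒s _)
      indicator-positive false true  _   = refl
      indicator-positive false false _   = refl

      indicator-negative : ∀ l s → (T l → ¬ T s) → (if l then 1ℚ else 0ℚ) ≡ ℚ.- fromℤ (sgn s ℤ.* + indicator l)
      indicator-negative true  true  l⇒¬s = ⊥-elim (l⇒¬s _ _)
      indicator-negative true  false _    = refl
      indicator-negative false true  _    = refl
      indicator-negative false false _    = refl

      vertex : ℕ → Point d
      vertex t a = fromℤ (sgn (lookup W a) ℤ.* + indicator (layer t a))

      layerSet : ℕ → Subset d
      layerSet t = tabulate (layer t)

      lookup-layerSet : ∀ t a → lookup (layerSet t) a ≡ layer t a
      lookup-layerSet t a = VecP.lookup∘tabulate (layer t) a

      vertex∈generators : ∀ t → ChainPolytope P (vertex t) ⊎ neg (ChainPolytope Q) (vertex t)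
      vertex∈generators t with any? (λ a → T? (layer t a ∧ lookup W a))
      ... | yes (a₀ , a₀∈) = inj₁ (Conv-point _ (layerSet t , antichain , refl) coordinates)
        where
        layer⊆W : ∀ a → T (layer t a) → T (lookup W a)
        layer⊆W a a∈ with T? (lookup W a)
        ... | yes a∈W = a∈W
        ... | no a∉W = ⊥-elim (layer-antichain t a₀ a (proj₁ (to T-∧ a₀∈)) a∈ a₀≢a (W≤Δ∁W W a₀ a (proj₂ (to T-∧ a₀∈)) a∉W))
          where
          a₀≢a : a₀ ≢ a
          a₀≢a refl = a∉W (proj₂ (to T-∧ a₀∈))
        antichain : IsAntichain P (layerSet t)
        antichain a b a∈ b∈ a≢b a≤b = layer-antichain t a b a∈′ b∈′ a≢b (≤P⇒≤Δ W a b (layer⊆W a a∈′) (layer⊆W b b∈′) a≤b)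
          where
          a∈′ = subst T (lookup-layerSet t a) a∈
          b∈′ = subst T (lookup-layerSet t b) b∈
        coordinates : ∀ i → ρ (layerSet t) i ≡ vertex t i
        coordinates i = trans (cong (λ b → if b then 1ℚ else 0ℚ) (lookup-layerSet t i))
                              (indicator-positive (layer t i) (lookup W i) (layer⊆W i))
      ... | no none = inj₂ (Conv-point _ (layerSet t , antichain , refl) coordinates)
        where
        layer⊆∁W : ∀ a → T (layer t a) → ¬ T (lookup W a)
        layer⊆∁W a a∈ a∈W = none (a , from T-∧ (a∈ , a∈W))
        antichain : IsAntichain Q (layerSet t)
        antichain a b a∈ b∈ a≢b a≤b = layer-antichain t a b a∈′ b∈′ a≢b (≤Q⇒≤Δ W a b (layer⊆∁W a a∈′) (layer⊆∁W b b∈′) a≤b)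
          where
          a∈′ = subst T (lookup-layerSet t a) a∈
          b∈′ = subst T (lookup-layerSet t b) b∈
        coordinates : ∀ i → ρ (layerSet t) i ≡ ℚ.- vertex t i
        coordinates i = trans (cong (λ b → if b then 1ℚ else 0ℚ) (lookup-layerSet t i))
                              (indicator-negative (layer t i) (lookup W i) (layer⊆∁W i))

      combCoord-vertices : ∀ t a → combCoord (uniformCombination w vertex t) a ≡
        fromℤ (sgn (lookup W a) ℤ.* + countUpTo t (λ s → layer s a)) ℚ.* w
      combCoord-vertices zero a = sym (trans (cong (λ k → fromℤ k ℚ.* w) (ℤP.*-zeroʳ (sgn (lookup W a)))) (ℚP.*-zeroˡ w))
      combCoord-vertices (suc t) a = begin
        w ℚ.* fromℤ (σ ℤ.* + i) ℚ.+ combCoord (uniformCombination w vertex t) a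
          ≡⟨ cong (w ℚ.* fromℤ (σ ℤ.* + i) ℚ.+_) (combCoord-vertices t a) ⟩
        w ℚ.* fromℤ (σ ℤ.* + i) ℚ.+ fromℤ (σ ℤ.* + c) ℚ.* w
          ≡⟨ solve 3 (λ w p q → w :* p :+ q :* w := (p :+ q) :* w) refl w (fromℤ (σ ℤ.* + i)) (fromℤ (σ ℤ.* + c)) ⟩
        (fromℤ (σ ℤ.* + i) ℚ.+ fromℤ (σ ℤ.* + c)) ℚ.* w
          ≡⟨ cong (ℚ._* w) (sym (fromℤ-homo-+ (σ ℤ.* + i) (σ ℤ.* + c))) ⟩
        fromℤ (σ ℤ.* + i ℤ.+ σ ℤ.* + c) ℚ.* w
          ≡⟨ cong (λ k → fromℤ k ℚ.* w) (sym (ℤP.*-distribˡ-+ σ (+ i) (+ c))) ⟩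
        fromℤ (σ ℤ.* + (i ℕ.+ c)) ℚ.* w ∎
        where
        open ≡-Reasoning
        σ = sgn (lookup W a)
        i = indicator (layer (suc t) a)
        c = countUpTo t (λ s → layer s a)

    Bounded⇒Γ : Bounded (suc m) z → Gamma P Q (z / m)
    Bounded⇒Γ bounded =
      uniformCombination w vertex (suc m) ,
      uniformCombination-All _ vertex (suc m) (ℚP.nonNegative⁻¹ w {{ℚP.normalize-nonNeg 1 (suc m)}}) vertex∈generators ,
      trans (weightSum-uniform w vertex (suc m)) (fromℤ-*-inverse m) ,
      coordinates
      where
      layers-through : ∀ a → countUpTo (suc m) (λ t → layer t a) ≡ magnitudes z a
      layers-through a = begin
        countUpTo (suc m) (λ t → layer t a)   ≡⟨ countUpTo-interval (suc m) _ (h a) ⟩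
        suc m ℕ.⊓ h a ℕ.∸ ΔW.maxAbove h a     ≡⟨ cong (ℕ._∸ ΔW.maxAbove h a) (ℕP.m≥n⇒m⊓n≡n (bounded a)) ⟩
        h a ℕ.∸ ΔW.maxAbove h a               ≡⟨ cong (ℕ._∸ ΔW.maxAbove h a) (ΔW.height-rec (magnitudes z) a) ⟩
        magnitudes z a ℕ.+ ΔW.maxAbove h a ℕ.∸ ΔW.maxAbove h a ≡⟨ ℕP.m+n∸n≡m (magnitudes z a) (ΔW.maxAbove h a) ⟩
        magnitudes z a                        ∎
        where open ≡-Reasoning
      coordinates : ∀ a → combCoord (uniformCombination w vertex (suc m)) a ≡ (z / m) a
      coordinates a = begin
        combCoord (uniformCombination w vertex (suc m)) a
          ≡⟨ combCoord-vertices (suc m) a ⟩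
        fromℤ (sgn (lookup W a) ℤ.* + countUpTo (suc m) (λ t → layer t a)) ℚ.* w
          ≡⟨ cong (λ k → fromℤ (sgn (lookup W a) ℤ.* + k) ℚ.* w) (layers-through a) ⟩
        fromℤ (sgn (lookup W a) ℤ.* + magnitudes z a) ℚ.* w
          ≡⟨ cong (λ b → fromℤ (sgn b ℤ.* + magnitudes z a) ℚ.* w) (lookup-positives z a) ⟩
        fromℤ (sgn (isPositive (lookup z a)) ℤ.* + magnitudes z a) ℚ.* w
          ≡⟨ cong (λ k → fromℤ k ℚ.* w) (sgn-isPositive-*-abs (lookup z a)) ⟩
        fromℤ (lookup z a) ℚ.* w
          ≡⟨ sym (/-as-* (lookup z a) m) ⟩
        (z / m) a ∎
        where open ≡-Reasoning

module ListFacts where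

  open import Data.Nat using (ℕ; suc; _+_; _*_; _≤_; z≤n; s≤s)
  open import Data.Nat.Properties using (≤-trans; ≤-reflexive; *-distribʳ-+)
  open import Data.Nat.ListAction using (sum)
  open import Data.List using (List; []; _∷_; _++_; map; concatMap; length; cartesianProductWith)
  open import Data.List.Properties using (length-++; length-map)
  open import Data.List.Membership.Propositional using (_∈_; find; lose)
  open import Data.List.Membership.Propositional.Properties using (∈-map⁻; ∈-concatMap⁺; ∈-concatMap⁻)
  open import Data.List.Relation.Unary.Any using (here; there)
  open import Data.List.Relation.Unary.All as All using ([]; _∷_)
  open import Data.List.Relation.Unary.Unique.Propositional using (Unique; []; _∷_)
  open import Data.List.Relation.Unary.Unique.Propositional.Properties using (++⁺)
  open import Data.Product using (_×_; _,_; ∃; proj₁; proj₂)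
  open import Function using (_∘_)
  open import Data.Empty using (⊥; ⊥-elim)
  open import Relation.Binary.PropositionalEquality

  private variable
    A B C : Set

  ∈-concatMap⁺′ : ∀ (f : A → List B) {x xs c} → x ∈ xs → c ∈ f x → c ∈ concatMap f xs
  ∈-concatMap⁺′ f x∈xs c∈fx = ∈-concatMap⁺ f (lose x∈xs c∈fx)

  ∈-concatMap⁻′ : ∀ (f : A → List B) xs {c} → c ∈ concatMap f xs → ∃ λ x → x ∈ xs × c ∈ f x
  ∈-concatMap⁻′ f xs c∈ = find (∈-concatMap⁻ f {xs = xs} c∈)

  concatMap-map≡cartesianProductWith : ∀ (f : A → B → C) xs ys →
    concatMap (λ x → map (f x) ys) xs ≡ cartesianProductWith f xs ys
  concatMap-map≡cartesianProductWith f []       ys = refl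
  concatMap-map≡cartesianProductWith f (x ∷ xs) ys = cong (map (f x) ys ++_) (concatMap-map≡cartesianProductWith f xs ys)

  length-cartesianProductWith : ∀ (f : A → B → C) xs ys → length (cartesianProductWith f xs ys) ≡ length xs * length ys
  length-cartesianProductWith f []       ys = refl
  length-cartesianProductWith f (x ∷ xs) ys =
    trans (length-++ (map (f x) ys)) (cong₂ _+_ (length-map (f x) ys) (length-cartesianProductWith f xs ys))

  length-concatMap : ∀ (f : A → List B) (g : A → ℕ) c xs → (∀ x → length (f x) ≡ g x * c) →
    length (concatMap f xs) ≡ sum (map g xs) * c
  length-concatMap f g c []       _   = refl
  length-concatMap f g c (x ∷ xs) len =
    trans (length-++ (f x)) (trans (cong₂ _+_ (len x) (length-concatMap f g c xs len)) (sym (*-distribʳ-+ c (g x) _)))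

  Unique-map : ∀ (f : A → B) {xs} → Unique xs → (∀ {x x′} → x ∈ xs → x′ ∈ xs → f x ≡ f x′ → x ≡ x′) → Unique (map f xs)
  Unique-map f {[]}     []         inj = []
  Unique-map f {x ∷ xs} (x∉ ∷ xs!) inj = All.tabulate fx∉ ∷ Unique-map f xs! (λ p q → inj (there p) (there q))
    where
    fx∉ : ∀ {c} → c ∈ map f xs → f x ≢ c
    fx∉ c∈ fx≡c with ∈-map⁻ f c∈
    ... | x′ , x′∈xs , refl = All.lookup x∉ x′∈xs (inj (here refl) (there x′∈xs) fx≡c)

  Unique-concatMap : ∀ (f : A → List B) {xs} → Unique xs → (∀ {x} → x ∈ xs → Unique (f x)) →
    (∀ {x x′ c} → x ∈ xs → x′ ∈ xs → c ∈ f x → c ∈ f x′ → x ≡ x′) → Unique (concatMap f xs)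
  Unique-concatMap f {[]}     []         f! disjoint = []
  Unique-concatMap f {x ∷ xs} (x∉ ∷ xs!) f! disjoint =
    ++⁺ (f! (here refl)) (Unique-concatMap f xs! (f! ∘ there) (λ p q → disjoint (there p) (there q))) separate
    where
    separate : ∀ {c} → c ∈ f x × c ∈ concatMap f xs → ⊥
    separate (c∈fx , c∈rest) with ∈-concatMap⁻′ f xs c∈rest
    ... | x′ , x′∈xs , c∈fx′ = All.lookup x∉ x′∈xs (disjoint (here refl) (there x′∈xs) c∈fx c∈fx′)

  Unique-cartesianProductWith : ∀ (f : A → B → C) {xs ys} → Unique xs → Unique ys →
    (∀ {x x′ y y′} → x ∈ xs → x′ ∈ xs → y ∈ ys → y′ ∈ ys → f x y ≡ f x′ y′ → x ≡ x′ × y ≡ y′) →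
    Unique (cartesianProductWith f xs ys)
  Unique-cartesianProductWith f {xs} {ys} xs! ys! inj = subst Unique (concatMap-map≡cartesianProductWith f xs ys)
    (Unique-concatMap (λ x → map (f x) ys) xs!
      (λ x∈ → Unique-map (f _) ys! (λ y∈ y′∈ eq → proj₂ (inj x∈ x∈ y∈ y′∈ eq)))
      (λ x∈ x′∈ c∈ c∈′ → disjoint x∈ x′∈ (∈-map⁻ _ c∈) (∈-map⁻ _ c∈′)))
    where
    disjoint : ∀ {x x′ c} → x ∈ xs → x′ ∈ xs → ∃ (λ y → y ∈ ys × c ≡ f x y) → ∃ (λ y → y ∈ ys × c ≡ f x′ y) → x ≡ x′
    disjoint x∈ x′∈ (y , y∈ , refl) (y′ , y′∈ , eq) = proj₁ (inj x∈ x′∈ y∈ y′∈ eq)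

  private
    remove : ∀ {x : A} ys → x ∈ ys → List A
    remove (y ∷ ys) (here _)  = ys
    remove (y ∷ ys) (there p) = y ∷ remove ys p

    length-remove : ∀ {x : A} ys (p : x ∈ ys) → suc (length (remove ys p)) ≡ length ys
    length-remove (y ∷ ys) (here _)  = refl
    length-remove (y ∷ ys) (there p) = cong suc (length-remove ys p)

    ∈-remove : ∀ {x c : A} ys (p : x ∈ ys) → c ∈ ys → c ≢ x → c ∈ remove ys p
    ∈-remove (y ∷ ys) (here refl) (here refl) c≢x = ⊥-elim (c≢x refl)
    ∈-remove (y ∷ ys) (here refl) (there q)   c≢x = q
    ∈-remove (y ∷ ys) (there p)   (here refl) c≢x = here refl
    ∈-remove (y ∷ ys) (there p)   (there q)   c≢x = there (∈-remove ys p q c≢x)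

  Unique⇒length≤ : ∀ {xs ys : List A} → Unique xs → (∀ {c} → c ∈ xs → c ∈ ys) → length xs ≤ length ys
  Unique⇒length≤ {xs = []}     []         xs⊆ys = z≤n
  Unique⇒length≤ {xs = x ∷ xs} {ys} (x∉ ∷ xs!) xs⊆ys =
    ≤-trans (s≤s (Unique⇒length≤ xs! (λ c∈xs → ∈-remove ys x∈ys (xs⊆ys (there c∈xs)) (λ c≡x → All.lookup x∉ c∈xs (sym c≡x)))))
            (≤-reflexive (length-remove ys x∈ys))
    where
    x∈ys = xs⊆ys (here refl)

module Enumerations where

  open import Data.Nat using (ℕ; zero; suc; _≤_; s≤s)
  open import Data.Integer as ℤ using (ℤ; +_; -[1+_])
  import Data.Integer.Properties as ℤP
  open import Data.Fin using (zero; suc)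
  open import Data.Vec using (Vec; []; _∷_; lookup)
  open import Data.Vec.Properties using (∷-injective; tabulate∘lookup; tabulate-cong)
  open import Data.Bool using (true; false)
  open import Data.List using (List; []; _∷_; _++_; map; allFin; upTo; cartesianProductWith)
  open import Data.List.Membership.Propositional using (_∈_)
  open import Data.List.Membership.Propositional.Properties
    using (∈-++⁺ˡ; ∈-++⁺ʳ; ∈-map⁺; ∈-map⁻; ∈-upTo⁺; ∈-cartesianProductWith⁺)
  open import Data.List.Relation.Unary.Any using (here)
  open import Data.List.Relation.Unary.Unique.Propositional using (Unique)
  open import Data.List.Relation.Unary.AllPairs using ([]; _∷_)
  open import Data.List.Relation.Unary.All using ([])
  open import Data.List.Relation.Unary.Unique.Propositional.Properties using (++⁺; map⁺; upTo⁺; cartesianProductWith⁺)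
  open import Data.Product using (_×_; _,_)
  open import Relation.Nullary using (¬_)
  open import Relation.Binary.PropositionalEquality
  open import Defs using (allVecs; allSubsets)
  open ListFacts using (concatMap-map≡cartesianProductWith)

  private variable
    A : Set

  allVectors : List A → (k : ℕ) → List (Vec A k)
  allVectors xs zero    = [] ∷ []
  allVectors xs (suc k) = cartesianProductWith _∷_ xs (allVectors xs k)

  ∈-allVectors⁺ : ∀ (xs : List A) {k} (v : Vec A k) → (∀ i → lookup v i ∈ xs) → v ∈ allVectors xs k
  ∈-allVectors⁺ xs []      _  = here refl
  ∈-allVectors⁺ xs (x ∷ v) v⊆xs = ∈-cartesianProductWith⁺ _∷_ (v⊆xs zero) (∈-allVectors⁺ xs v (λ i → v⊆xs (suc i)))

  Unique-allVectors : ∀ {xs : List A} k → Unique xs → Unique (allVectors xs k)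
  Unique-allVectors zero    xs! = [] ∷ []
  Unique-allVectors (suc k) xs! = cartesianProductWith⁺ _∷_ ∷-injective xs! (Unique-allVectors k xs!)

  allVecs≡allVectors : ∀ {d} k → allVecs {d} k ≡ allVectors (allFin d) k
  allVecs≡allVectors zero    = refl
  allVecs≡allVectors {d} (suc k) =
    trans (cong (λ L → Data.List.concatMap (λ x → map (x ∷_) L) (allFin d)) (allVecs≡allVectors k))
          (concatMap-map≡cartesianProductWith _∷_ (allFin d) (allVectors (allFin d) k))

  allSubsets≡allVectors : ∀ k → allSubsets k ≡ allVectors (true ∷ false ∷ []) k
  allSubsets≡allVectors zero    = refl
  allSubsets≡allVectors (suc k) =
    trans (cong (λ L → Data.List.concatMap (λ x → map (x ∷_) L) (true ∷ false ∷ [])) (allSubsets≡allVectors k))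
          (concatMap-map≡cartesianProductWith _∷_ (true ∷ false ∷ []) (allVectors (true ∷ false ∷ []) k))

  ≗⇒≡ : ∀ {A : Set} {k} (u v : Vec A k) → (∀ i → lookup u i ≡ lookup v i) → u ≡ v
  ≗⇒≡ u v u≗v = trans (sym (tabulate∘lookup u)) (trans (tabulate-cong u≗v) (tabulate∘lookup v))

  integersWithin : ℕ → List ℤ
  integersWithin n = map +_ (upTo (suc n)) ++ map -[1+_] (upTo n)

  ∈-integersWithin⁺ : ∀ n z → ℤ.∣ z ∣ ≤ n → z ∈ integersWithin n
  ∈-integersWithin⁺ n (+ k)    k≤n  = ∈-++⁺ˡ (∈-map⁺ +_ (∈-upTo⁺ (s≤s k≤n)))
  ∈-integersWithin⁺ n -[1+ k ] k<n  = ∈-++⁺ʳ (map +_ (upTo (suc n))) (∈-map⁺ -[1+_] (∈-upTo⁺ k<n))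

  Unique-integersWithin : ∀ n → Unique (integersWithin n)
  Unique-integersWithin n = ++⁺ (map⁺ ℤP.+-injective (upTo⁺ (suc n))) (map⁺ ℤP.-[1+-injective (upTo⁺ n)) disjoint
    where
    disjoint : ∀ {z} → ¬ (z ∈ map +_ (upTo (suc n)) × z ∈ map -[1+_] (upTo n))
    disjoint (p , q) with ∈-map⁻ +_ p | ∈-map⁻ -[1+_] q
    ... | _ , _ , refl | _ , _ , ()

module Permutations {d : ℕ} where

  open import Data.Nat as ℕ using (ℕ)
  open import Data.Fin using (Fin; _≟_; _<?_; _<_)
  open import Data.Fin.Properties using (any?)
  open import Data.Fin.Subset using (Subset)
  open import Data.Vec using (Vec; lookup)
  open import Data.List using (List; []; _∷_; foldr; allFin)
  open import Data.List.Membership.Propositional using (_∈_)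
  open import Data.List.Membership.Propositional.Properties using (∈-allFin)
  open import Data.List.Relation.Unary.Any using (here; there)
  open import Data.Bool using (Bool; true; false; T; _∧_; _∨_; not)
  open import Data.Product using (_,_)
  open import Data.Empty using (⊥-elim)
  open import Relation.Nullary using (yes; no)
  open import Relation.Nullary.Decidable using (⌊_⌋; toWitness; fromWitness)
  open import Relation.Binary.PropositionalEquality
  open import Defs using (FinPoset; allB; isPerm; isLinExt; ltΔ)
  open FinSort using (injective⇒surjective)

  private
    allB-foldr⁺ : (f : Fin d → Bool) (xs : List (Fin d)) → (∀ i → T (f i)) → T (foldr (λ i b → f i ∧ b) true xs)
    allB-foldr⁺ f []       all = _
    allB-foldr⁺ f (x ∷ xs) all with f x | all x
    ... | true | _ = allB-foldr⁺ f xs all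

    allB-foldr⁻ : (f : Fin d → Bool) (xs : List (Fin d)) → T (foldr (λ i b → f i ∧ b) true xs) → ∀ {i} → i ∈ xs → T (f i)
    allB-foldr⁻ f (x ∷ xs) all i∈ with f x in fx
    allB-foldr⁻ f (x ∷ xs) all (here refl) | true = subst T (sym fx) _
    allB-foldr⁻ f (x ∷ xs) all (there i∈) | true = allB-foldr⁻ f xs all i∈

    allB⁺ : (f : Fin d → Bool) → (∀ i → T (f i)) → T (allB f)
    allB⁺ f = allB-foldr⁺ f (allFin d)

    allB⁻ : (f : Fin d → Bool) → T (allB f) → ∀ i → T (f i)
    allB⁻ f all i = allB-foldr⁻ f (allFin d) all (∈-allFin i)

    implies⁺ : ∀ {x y} → (T x → T y) → T (not x ∨ y)
    implies⁺ {true}  x⇒y = x⇒y _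
    implies⁺ {false} _   = _

    implies⁻ : ∀ {x y} → T (not x ∨ y) → T x → T y
    implies⁻ {true} y _ = y

  isPerm⁻ : (σ : Vec (Fin d) d) → T (isPerm σ) → ∀ {a b} → lookup σ a ≡ lookup σ b → a ≡ b
  isPerm⁻ σ perm {a} {b} σa≡σb = toWitness {a? = a ≟ b}
    (implies⁻ {⌊ lookup σ a ≟ lookup σ b ⌋} (allB⁻ _ (allB⁻ _ perm a) b) (fromWitness σa≡σb))

  isPerm⁺ : (σ : Vec (Fin d) d) → (∀ {a b} → lookup σ a ≡ lookup σ b → a ≡ b) → T (isPerm σ)
  isPerm⁺ σ inj = allB⁺ _ (λ a → allB⁺ _ (λ b →
    implies⁺ {⌊ lookup σ a ≟ lookup σ b ⌋} (λ σa≡σb → fromWitness (inj (toWitness σa≡σb)))))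

  module _ (P Q : FinPoset d) (W : Subset d) where

    isLinExt⁻ : (σ : Vec (Fin d) d) → T (isLinExt P Q W σ) →
      ∀ {a b} → T (ltΔ P Q W (lookup σ a) (lookup σ b)) → a < b
    isLinExt⁻ σ ext {a} {b} σa<σb = toWitness {a? = a <? b}
      (implies⁻ {ltΔ P Q W (lookup σ a) (lookup σ b)} (allB⁻ _ (allB⁻ _ ext a) b) σa<σb)

    isLinExt⁺ : (σ : Vec (Fin d) d) → (∀ {a b} → T (ltΔ P Q W (lookup σ a) (lookup σ b)) → a < b) →
      T (isLinExt P Q W σ)
    isLinExt⁺ σ ext = allB⁺ _ (λ a → allB⁺ _ (λ b →
      implies⁺ {ltΔ P Q W (lookup σ a) (lookup σ b)} (λ σa<σb → fromWitness (ext σa<σb))))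

  position : Vec (Fin d) d → Fin d → Fin d
  position σ i with any? (λ a → lookup σ a ≟ i)
  ... | yes (a , _) = a
  ... | no _        = i

  lookup-position : (σ : Vec (Fin d) d) → T (isPerm σ) → ∀ i → lookup σ (position σ i) ≡ i
  lookup-position σ perm i with any? (λ a → lookup σ a ≟ i)
  ... | yes (a , σa≡i) = σa≡i
  ... | no none = ⊥-elim (none (injective⇒surjective (lookup σ) (isPerm⁻ σ perm) i))

  position-lookup : (σ : Vec (Fin d) d) → T (isPerm σ) → ∀ a → position σ (lookup σ a) ≡ a
  position-lookup σ perm a = isPerm⁻ σ perm (lookup-position σ perm (lookup σ a))

module Arithmetic where

  open import Data.Nat
  open import Data.Nat.Properties
  open import Relation.Binary.PropositionalEquality
  open import Data.Nat.Solver using (module +-*-Solver)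
  open +-*-Solver using (solve; _:+_; _:*_; _:=_; con)
  open ≤-Reasoning
  open import Relation.Binary.Definitions using (tri<; tri≈; tri>)
  open import Data.Product using (_×_; _,_)
  open import Data.Empty using (⊥-elim)

  sumBelow : ℕ → (ℕ → ℕ) → ℕ
  sumBelow zero f = 0
  sumBelow (suc j) f = f j + sumBelow j f

  sumBelow-mono-≤ : ∀ n (f g : ℕ → ℕ) → (∀ j → f j ≤ g j) → sumBelow n f ≤ sumBelow n g
  sumBelow-mono-≤ zero f g h = z≤n
  sumBelow-mono-≤ (suc n) f g h = +-mono-≤ (h n) (sumBelow-mono-≤ n f g h)

  *-distribˡ-sumBelow : ∀ n c (f : ℕ → ℕ) → c * sumBelow n f ≡ sumBelow n (λ j → c * f j)
  *-distribˡ-sumBelow zero c f = *-zeroʳ c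
  *-distribˡ-sumBelow (suc n) c f = trans (*-distribˡ-+ c (f n) _) (cong (c * f n +_) (*-distribˡ-sumBelow n c f))

  sumBelow-shift : ∀ n k (f : ℕ → ℕ) → sumBelow n (λ i → f (i + k)) ≤ sumBelow (n + k) f
  sumBelow-shift zero k f = z≤n
  sumBelow-shift (suc n) k f = +-monoʳ-≤ (f (n + k)) (sumBelow-shift n k f)

  suc-^-lower : ∀ a k → a ^ suc k + suc k * a ^ k ≤ suc a ^ suc k
  suc-^-lower a zero = ≤-reflexive (+-comm (a * 1) 1)
  suc-^-lower a (suc k) = begin
    a ^ suc (suc k) + suc (suc k) * a ^ suc k
      ≤⟨ +-monoʳ-≤ (a ^ suc (suc k)) (+-monoʳ-≤ (a ^ suc k) (m≤m+n (suc k * a ^ suc k) (suc k * a ^ k))) ⟩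
    a ^ suc (suc k) + (a ^ suc k + (suc k * a ^ suc k + suc k * a ^ k))
      ≡⟨ solve 3 (λ a p kk → a :* (a :* p) :+ (a :* p :+ (kk :* (a :* p) :+ kk :* p)) := (con 1 :+ a) :* (a :* p :+ kk :* p)) refl a (a ^ k) (suc k) ⟩
    suc a * (a ^ suc k + suc k * a ^ k)
      ≤⟨ *-monoʳ-≤ (suc a) (suc-^-lower a k) ⟩
    suc a ^ suc (suc k) ∎

  suc-^-upper : ∀ a k → suc a ^ suc k ≤ a ^ suc k + suc k * suc a ^ k
  suc-^-upper a zero = ≤-reflexive (+-comm 1 (a * 1))
  suc-^-upper a (suc k) = begin
    suc a ^ suc (suc k)
      ≤⟨ *-monoʳ-≤ (suc a) (suc-^-upper a k) ⟩
    suc a * (a ^ suc k + suc k * suc a ^ k)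
      ≡⟨ solve 4 (λ a p q kk → (con 1 :+ a) :* (a :* p :+ kk :* q) := a :* (a :* p) :+ (a :* p :+ kk :* ((con 1 :+ a) :* q))) refl a (a ^ k) (suc a ^ k) (suc k) ⟩
    a ^ suc (suc k) + (a ^ suc k + suc k * suc a ^ suc k)
      ≤⟨ +-monoʳ-≤ (a ^ suc (suc k)) (+-monoˡ-≤ (suc k * suc a ^ suc k) (^-monoˡ-≤ (suc k) (n≤1+n a))) ⟩
    a ^ suc (suc k) + (suc a ^ suc k + suc k * suc a ^ suc k)
      ≡⟨⟩
    a ^ suc (suc k) + suc (suc k) * suc a ^ suc k ∎

  sumBelow-^-upper : ∀ c m k → suc k * sumBelow m (λ j → (c + j) ^ k) + c ^ suc k ≤ (c + m) ^ suc k
  sumBelow-^-upper c zero k = ≤-reflexive (trans (cong (_+ c ^ suc k) (*-zeroʳ (suc k))) (cong (_^ suc k) (sym (+-identityʳ c))))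
  sumBelow-^-upper c (suc m) k = begin
    suc k * ((c + m) ^ k + sumBelow m (λ j → (c + j) ^ k)) + c ^ suc k
      ≡⟨ solve 4 (λ kk p s q → kk :* (p :+ s) :+ q := (kk :* s :+ q) :+ kk :* p) refl (suc k) ((c + m) ^ k) (sumBelow m (λ j → (c + j) ^ k)) (c ^ suc k) ⟩
    (suc k * sumBelow m (λ j → (c + j) ^ k) + c ^ suc k) + suc k * (c + m) ^ k
      ≤⟨ +-monoˡ-≤ (suc k * (c + m) ^ k) (sumBelow-^-upper c m k) ⟩
    (c + m) ^ suc k + suc k * (c + m) ^ k
      ≤⟨ suc-^-lower (c + m) k ⟩
    suc (c + m) ^ suc k
      ≡⟨ cong (_^ suc k) (sym (+-suc c m)) ⟩
    (c + suc m) ^ suc k ∎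

  sumBelow-^-lower : ∀ m k → m ^ suc k ≤ suc k * sumBelow (suc m) (λ i → i ^ k)
  sumBelow-^-lower zero k = z≤n
  sumBelow-^-lower (suc m) k = begin
    suc m ^ suc k
      ≤⟨ suc-^-upper m k ⟩
    m ^ suc k + suc k * suc m ^ k
      ≤⟨ +-monoˡ-≤ (suc k * suc m ^ k) (sumBelow-^-lower m k) ⟩
    suc k * sumBelow (suc m) (λ i → i ^ k) + suc k * suc m ^ k
      ≡⟨ trans (+-comm _ (suc k * suc m ^ k)) (sym (*-distribˡ-+ (suc k) (suc m ^ k) _)) ⟩
    suc k * sumBelow (suc (suc m)) (λ i → i ^ k) ∎

  *-+-^-upper : ∀ a c d → a * (a + c) ^ d ≤ a * a ^ d + d * c * (a + c) ^ d
  *-+-^-upper a c zero = ≤-reflexive (sym (+-identityʳ (a * 1)))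
  *-+-^-upper a c (suc d) = begin
    a * ((a + c) * (a + c) ^ d)
      ≡⟨ solve 3 (λ a c p → a :* ((a :+ c) :* p) := (a :+ c) :* (a :* p)) refl a c ((a + c) ^ d) ⟩
    (a + c) * (a * (a + c) ^ d)
      ≤⟨ *-monoʳ-≤ (a + c) (*-+-^-upper a c d) ⟩
    (a + c) * (a * a ^ d + d * c * (a + c) ^ d)
      ≡⟨ solve 5 (λ a c p q dd → (a :+ c) :* (a :* p :+ dd :* c :* q) := a :* (a :* p) :+ (c :* (a :* p) :+ dd :* c :* ((a :+ c) :* q))) refl a c (a ^ d) ((a + c) ^ d) d ⟩
    a * (a * a ^ d) + (c * (a * a ^ d) + d * c * ((a + c) * (a + c) ^ d))
      ≤⟨ +-monoʳ-≤ (a * (a * a ^ d)) (+-monoˡ-≤ (d * c * ((a + c) * (a + c) ^ d)) (*-monoʳ-≤ c (^-monoˡ-≤ (suc d) (m≤m+n a c)))) ⟩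
    a * (a * a ^ d) + (c * (a + c) ^ suc d + d * c * ((a + c) * (a + c) ^ d))
      ≡⟨ cong (a * (a * a ^ d) +_) (solve 3 (λ c q dd → c :* q :+ dd :* c :* q := (con 1 :+ dd) :* c :* q) refl c ((a + c) ^ suc d) d) ⟩
    a * a ^ suc d + suc d * c * (a + c) ^ suc d ∎

  radix-<ˡ : ∀ B {a a′ r r′} → a < a′ → r < B → a * B + r < a′ * B + r′
  radix-<ˡ B {a} {a′} {r} {r′} lt rb = begin-strict
    a * B + r <⟨ +-monoʳ-< (a * B) rb ⟩
    a * B + B ≡⟨ +-comm (a * B) B ⟩
    suc a * B ≤⟨ *-monoˡ-≤ B lt ⟩
    a′ * B ≤⟨ m≤m+n (a′ * B) r′ ⟩
    a′ * B + r′ ∎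

  radix-<ʳ : ∀ B {a a′ r r′} → a ≤ a′ → r < r′ → a * B + r < a′ * B + r′
  radix-<ʳ B le lt = +-mono-≤-< (*-monoˡ-≤ B le) lt

  radix-injective : ∀ B {a a′ r r′} → r < B → r′ < B → a * B + r ≡ a′ * B + r′ → a ≡ a′ × r ≡ r′
  radix-injective B {a} {a′} rb rb′ e with <-cmp a a′
  ... | tri< lt _ _ = ⊥-elim (<-irrefl e (radix-<ˡ B lt rb))
  ... | tri> _ _ gt = ⊥-elim (<-irrefl (sym e) (radix-<ˡ B gt rb′))
  ... | tri≈ _ refl _ = refl , +-cancelˡ-≡ (a * B) _ _ e



module DecreasingSequences where

  open import Data.Nat
  open import Data.Nat.Properties
  open import Data.Fin as F using (zero; suc)
  open import Data.Vec as Vec using (Vec; []; _∷_; lookup)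
  open import Data.List using (List; []; _∷_; _++_; map; length)
  open import Data.List.Membership.Propositional using (_∈_)
  open import Data.List.Membership.Propositional.Properties using (∈-++⁺ˡ; ∈-++⁺ʳ; ∈-++⁻; ∈-map⁺; ∈-map⁻)
  open import Data.List.Relation.Unary.Unique.Propositional using (Unique)
  open import Data.List.Relation.Unary.Unique.Propositional.Properties using (++⁺; map⁺)
  open import Data.List.Relation.Unary.AllPairs using ([]; _∷_)
  open import Data.List.Relation.Unary.All using ([])
  open import Data.List.Relation.Unary.Any using (here)
  open import Data.Product using (_×_; _,_; proj₁; proj₂; map₁)
  open import Data.Sum using (inj₁; inj₂)
  open import Data.Empty using (⊥-elim)
  open import Relation.Nullary using (¬_)
  open import Relation.Binary.PropositionalEquality
  import Data.List.Properties as LP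
  import Data.Vec.Properties as VecP
  open Arithmetic
  open ≤-Reasoning

  decreasing : ℕ → (k : ℕ) → List (Vec ℕ k)
  decreasing m       zero    = [] ∷ []
  decreasing zero    (suc k) = []
  decreasing (suc j) (suc k) = map (j ∷_) (decreasing j k) ++ decreasing j (suc k)

  nonIncreasing : ℕ → (k : ℕ) → List (Vec ℕ k)
  nonIncreasing m       zero    = [] ∷ []
  nonIncreasing zero    (suc k) = []
  nonIncreasing (suc j) (suc k) = map (j ∷_) (nonIncreasing (suc j) k) ++ nonIncreasing j (suc k)

  ∈-decreasing⁻ : ∀ m k {x s} → x ∷ s ∈ decreasing m (suc k) → x < m × s ∈ decreasing x k
  ∈-decreasing⁻ (suc j) k x∷s∈ with ∈-++⁻ (map (j ∷_) (decreasing j k)) x∷s∈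
  ... | inj₂ p = map₁ m<n⇒m<1+n (∈-decreasing⁻ j k p)
  ... | inj₁ p with ∈-map⁻ (j ∷_) p
  ...   | s′ , s′∈ , refl = ≤-refl , s′∈

  ∈-decreasing⇒< : ∀ m k {s} → s ∈ decreasing m k → ∀ a → lookup s a < m
  ∈-decreasing⇒< m (suc k) {x ∷ s} s∈ zero    = proj₁ (∈-decreasing⁻ m k s∈)
  ∈-decreasing⇒< m (suc k) {x ∷ s} s∈ (suc a) = <-trans (∈-decreasing⇒< x k (proj₂ (∈-decreasing⁻ m k s∈)) a) (proj₁ (∈-decreasing⁻ m k s∈))

  ∈-decreasing⇒decreasing : ∀ m k {s} → s ∈ decreasing m k → ∀ {a b} → a F.< b → lookup s b < lookup s a
  ∈-decreasing⇒decreasing m (suc k) {x ∷ s} s∈ {zero}  {suc b} _       = ∈-decreasing⇒< x k (proj₂ (∈-decreasing⁻ m k s∈)) b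
  ∈-decreasing⇒decreasing m (suc k) {x ∷ s} s∈ {suc a} {suc b} (s≤s a<b) = ∈-decreasing⇒decreasing x k (proj₂ (∈-decreasing⁻ m k s∈)) a<b

  Unique-decreasing : ∀ m k → Unique (decreasing m k)
  Unique-decreasing m       zero    = [] ∷ []
  Unique-decreasing zero    (suc k) = []
  Unique-decreasing (suc j) (suc k) =
    ++⁺ (map⁺ VecP.∷-injectiveʳ (Unique-decreasing j k)) (Unique-decreasing j (suc k)) disjoint
    where
    disjoint : ∀ {s} → ¬ (s ∈ map (j ∷_) (decreasing j k) × s ∈ decreasing j (suc k))
    disjoint (s∈ , s∈′) with ∈-map⁻ (j ∷_) s∈
    ... | _ , _ , refl = <-irrefl refl (proj₁ (∈-decreasing⁻ j k s∈′))

  ∈-nonIncreasing⁺ : ∀ m k (t : Vec ℕ k) → (∀ a → lookup t a < m) → (∀ {a b} → a F.< b → lookup t b ≤ lookup t a) →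
    t ∈ nonIncreasing m k
  ∈-nonIncreasing⁺ m       zero    []      _     _     = here refl
  ∈-nonIncreasing⁺ (suc j) (suc k) (x ∷ t) t<m t-dec with m≤n⇒m<n∨m≡n (t<m zero)
  ... | inj₂ refl = ∈-++⁺ˡ (∈-map⁺ (x ∷_) (∈-nonIncreasing⁺ (suc x) k t t≤x (λ {a} {b} a<b → t-dec {suc a} {suc b} (s≤s a<b))))
    where
    t≤x : ∀ a → lookup t a < suc x
    t≤x a = s≤s (t-dec {zero} {suc a} (s≤s z≤n))
  ... | inj₁ (s≤s x<j) = ∈-++⁺ʳ (map (j ∷_) (nonIncreasing (suc j) k)) (∈-nonIncreasing⁺ j (suc k) (x ∷ t) t<j t-dec)
    where
    t<j : ∀ a → lookup (x ∷ t) a < j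
    t<j zero    = x<j
    t<j (suc a) = ≤-<-trans (t-dec {zero} {suc a} (s≤s z≤n)) x<j
  ∈-nonIncreasing⁺ zero    (suc k) (x ∷ t) t<0 _ = ⊥-elim (n≮0 (t<0 zero))

  length-decreasing : ∀ m k → length (decreasing m (suc k)) ≡ sumBelow m (λ j → length (decreasing j k))
  length-decreasing zero k = refl
  length-decreasing (suc j) k = trans (LP.length-++ (map (j ∷_) (decreasing j k)))
    (cong₂ _+_ (LP.length-map (j ∷_) (decreasing j k)) (length-decreasing j k))

  length-nonIncreasing : ∀ m k → length (nonIncreasing m (suc k)) ≡ sumBelow m (λ j → length (nonIncreasing (suc j) k))
  length-nonIncreasing zero k = refl
  length-nonIncreasing (suc j) k = trans (LP.length-++ (map (j ∷_) (nonIncreasing (suc j) k)))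
    (cong₂ _+_ (LP.length-map (j ∷_) (nonIncreasing (suc j) k)) (length-nonIncreasing j k))

  ^≤!*length-decreasing : ∀ k m → m ^ k ≤ k ! * length (decreasing (m + k) k)
  ^≤!*length-decreasing zero m = ≤-refl
  ^≤!*length-decreasing (suc k) m = begin
    m ^ suc k
      ≤⟨ sumBelow-^-lower m k ⟩
    suc k * sumBelow (suc m) (λ i → i ^ k)
      ≤⟨ *-monoʳ-≤ (suc k) (sumBelow-mono-≤ (suc m) _ _ (λ i → ^≤!*length-decreasing k i)) ⟩
    suc k * sumBelow (suc m) (λ i → k ! * length (decreasing (i + k) k))
      ≡⟨ cong (suc k *_) (sym (*-distribˡ-sumBelow (suc m) (k !) (λ i → length (decreasing (i + k) k)))) ⟩
    suc k * (k ! * sumBelow (suc m) (λ i → length (decreasing (i + k) k)))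
      ≤⟨ *-monoʳ-≤ (suc k) (*-monoʳ-≤ (k !) (sumBelow-shift (suc m) k (λ j → length (decreasing j k)))) ⟩
    suc k * (k ! * sumBelow (suc m + k) (λ j → length (decreasing j k)))
      ≡⟨ sym (*-assoc (suc k) (k !) _) ⟩
    suc k ! * sumBelow (suc m + k) (λ j → length (decreasing j k))
      ≡⟨ cong (suc k ! *_) (sym (length-decreasing (suc m + k) k)) ⟩
    suc k ! * length (decreasing (suc m + k) (suc k))
      ≡⟨ cong (λ x → suc k ! * length (decreasing x (suc k))) (sym (+-suc m k)) ⟩
    suc k ! * length (decreasing (m + suc k) (suc k)) ∎

  !*length-nonIncreasing≤^ : ∀ k m → k ! * length (nonIncreasing m k) ≤ (m + k) ^ k
  !*length-nonIncreasing≤^ zero m = ≤-refl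
  !*length-nonIncreasing≤^ (suc k) m = begin
    suc k ! * length (nonIncreasing m (suc k))
      ≡⟨ cong (suc k ! *_) (length-nonIncreasing m k) ⟩
    suc k ! * sumBelow m (λ j → length (nonIncreasing (suc j) k))
      ≡⟨ trans (*-assoc (suc k) (k !) _) (cong (suc k *_) (*-distribˡ-sumBelow m (k !) _)) ⟩
    suc k * sumBelow m (λ j → k ! * length (nonIncreasing (suc j) k))
      ≤⟨ *-monoʳ-≤ (suc k) (sumBelow-mono-≤ m _ _ (λ j → ≤-trans (!*length-nonIncreasing≤^ k (suc j)) (≤-reflexive (cong (_^ k) (e j))))) ⟩
    suc k * sumBelow m (λ j → (suc k + j) ^ k)
      ≤⟨ m≤m+n _ _ ⟩
    suc k * sumBelow m (λ j → (suc k + j) ^ k) + suc k ^ suc k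
      ≤⟨ sumBelow-^-upper (suc k) m k ⟩
    (suc k + m) ^ suc k
      ≡⟨ cong (_^ suc k) (+-comm (suc k) m) ⟩
    (m + suc k) ^ suc k ∎
    where
    e : ∀ j → suc j + k ≡ suc k + j
    e j = cong suc (+-comm j k)



module Counting {d : ℕ} (P Q : Defs.FinPoset d) where

  open import Data.Nat as ℕ using (ℕ; suc; _≤_; _<_; s≤s; _∸_; _+_; _*_; _^_; _!)
  import Data.Nat.Properties as ℕP
  open import Algebra.Properties.CommutativeSemigroup ℕP.*-commutativeSemigroup using (x∙yz≈y∙xz)
  open import Data.Nat.ListAction using (sum)
  open import Data.Integer as ℤ using (ℤ; +_)
  open import Data.Fin as Fin using (Fin; toℕ)
  import Data.Fin.Properties as FinP
  open import Data.Fin.Subset using (Subset)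
  open import Data.Vec using (Vec; []; _∷_; lookup; tabulate)
  import Data.Vec.Properties as VecP
  open import Data.Bool using (Bool; true; false; T; _∧_)
  open import Data.Bool.Properties using (T?; T-∧)
  open import Data.Product using (∃; _×_; _,_; proj₁; proj₂)
  open import Data.Empty using (⊥-elim)
  open import Data.List using (List; []; _∷_; map; concatMap; length; filter; allFin; cartesianProductWith)
  open import Data.List.Membership.Propositional using (_∈_)
  open import Data.List.Membership.Propositional.Properties
    using (∈-filter⁺; ∈-filter⁻; ∈-allFin; ∈-cartesianProductWith⁺; ∈-cartesianProductWith⁻)
  open import Data.List.Relation.Unary.Any using (here; there)
  open import Data.List.Relation.Unary.Unique.Propositional using (Unique)
  import Data.List.Relation.Unary.Unique.Propositional.Properties as UniqueP
  open import Function using (Equivalence)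
  open import Relation.Nullary using (Dec)
  open import Relation.Binary using (tri<; tri≈; tri>)
  open import Relation.Binary.PropositionalEquality
  open import Defs using (FinPoset; isPerm; isLinExt; ltΔ; allVecs; allSubsets; e)
  open Equivalence using (to; from)
  open OrdinalSum P Q
  open LatticePoints P Q
  open Signs
  open ListFacts
  open Enumerations
  open DecreasingSequences
  open Permutations
  open Arithmetic using (radix-<ˡ; radix-<ʳ; radix-injective)

  IsLinearExtension : Subset d → Vec (Fin d) d → Set
  IsLinearExtension W σ = T (isPerm σ ∧ isLinExt P Q W σ)

  linearExtensions : Subset d → List (Vec (Fin d) d)
  linearExtensions W = filter (λ σ → T? (isPerm σ ∧ isLinExt P Q W σ)) (allVecs d)

  ∈-linearExtensions⁻ : ∀ W {σ} → σ ∈ linearExtensions W → IsLinearExtension W σ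
  ∈-linearExtensions⁻ W σ∈ = proj₂ (∈-filter⁻ (λ σ → T? (isPerm σ ∧ isLinExt P Q W σ)) {xs = allVecs d} σ∈)

  ∈-linearExtensions⁺ : ∀ W {σ} → IsLinearExtension W σ → σ ∈ linearExtensions W
  ∈-linearExtensions⁺ W {σ} ext = ∈-filter⁺ (λ σ → T? (isPerm σ ∧ isLinExt P Q W σ))
    (subst (σ ∈_) (sym (allVecs≡allVectors d)) (∈-allVectors⁺ (allFin d) σ (λ i → ∈-allFin _))) ext

  Unique-linearExtensions : ∀ W → Unique (linearExtensions W)
  Unique-linearExtensions W = UniqueP.filter⁺ (λ σ → T? (isPerm σ ∧ isLinExt P Q W σ))
    (subst Unique (sym (allVecs≡allVectors d)) (Unique-allVectors d (UniqueP.allFin⁺ d)))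

  ∈-allSubsets : ∀ W → W ∈ allSubsets d
  ∈-allSubsets W = subst (W ∈_) (sym (allSubsets≡allVectors d)) (∈-allVectors⁺ _ W (λ i → bool∈ (lookup W i)))
    where
    bool∈ : ∀ b → b ∈ true ∷ false ∷ []
    bool∈ true  = here refl
    bool∈ false = there (here refl)

  Unique-allSubsets : Unique (allSubsets d)
  Unique-allSubsets = subst Unique (sym (allSubsets≡allVectors d)) (Unique-allVectors d (((λ ()) ∷ []) ∷ [] ∷ []))
    where
    open import Data.List.Relation.Unary.AllPairs using ([]; _∷_)
    open import Data.List.Relation.Unary.All using ([]; _∷_)

  bounded? : ∀ n z → Dec (Bounded n z)
  bounded? n z = FinP.all? (λ i → height z i ℕP.≤? n)

  latticePoints : ℕ → List (Vec ℤ d)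
  latticePoints n = filter (bounded? n) (allVectors (integersWithin n) d)

  ∈-latticePoints⁺ : ∀ n z → Bounded n z → z ∈ latticePoints n
  ∈-latticePoints⁺ n z bounded = ∈-filter⁺ (bounded? n) (∈-allVectors⁺ _ z
    (λ i → ∈-integersWithin⁺ n (lookup z i) (ℕP.≤-trans (Height.y≤height (Δ (positives z)) (magnitudes z) i) (bounded i)))) bounded

  ∈-latticePoints⁻ : ∀ n {z} → z ∈ latticePoints n → Bounded n z
  ∈-latticePoints⁻ n z∈ = proj₂ (∈-filter⁻ (bounded? n) {xs = allVectors (integersWithin n) d} z∈)

  Unique-latticePoints : ∀ n → Unique (latticePoints n)
  Unique-latticePoints n = UniqueP.filter⁺ (bounded? n) (Unique-allVectors d (Unique-integersWithin n))

  module _ (W : Subset d) where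

    private
      module ΔW = Height (Δ W)

    fromHeights : (Fin d → ℕ) → Vec ℤ d
    fromHeights g = tabulate (λ i → sgn (lookup W i) ℤ.* + (g i ∸ ΔW.maxAbove g i))

    lookup-fromHeights : ∀ g i → lookup (fromHeights g) i ≡ sgn (lookup W i) ℤ.* + (g i ∸ ΔW.maxAbove g i)
    lookup-fromHeights g i = VecP.lookup∘tabulate _ i

    height-fromHeights : ∀ g → (∀ i → ΔW.maxAbove g i ≤ g i) → ∀ i → ΔW.height (magnitudes (fromHeights g)) i ≡ g i
    height-fromHeights g max≤g = ΔW.height-unique (magnitudes (fromHeights g)) g (λ i → begin
      g i                                          ≡⟨ sym (ℕP.m∸n+n≡m (max≤g i)) ⟩
      g i ∸ ΔW.maxAbove g i + ΔW.maxAbove g i       ≡⟨ cong (_+ ΔW.maxAbove g i) (sym (magnitude≡ i)) ⟩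
      magnitudes (fromHeights g) i + ΔW.maxAbove g i ∎)
      where
      open ≡-Reasoning
      magnitude≡ : ∀ i → magnitudes (fromHeights g) i ≡ g i ∸ ΔW.maxAbove g i
      magnitude≡ i = trans (cong ℤ.∣_∣ (lookup-fromHeights g i)) (abs-sgn-* (lookup W i) _)

  fromDecreasing : Subset d → Vec (Fin d) d → Vec ℕ d → Vec ℤ d
  fromDecreasing W σ s = fromHeights W (λ i → suc (lookup s (position σ i)))

  module Lower {n W σ s} (σ-ext : IsLinearExtension W σ) (s∈ : s ∈ decreasing n d) where

    private
      module ΔW = Height (Δ W)
      perm = proj₁ (to (T-∧ {isPerm σ}) σ-ext)
      ext  = proj₂ (to (T-∧ {isPerm σ}) σ-ext)

      g : Fin d → ℕ
      g i = suc (lookup s (position σ i))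

      ⊏⇒position< : ∀ {i j} → T (i ΔW.⊏ j) → position σ i Fin.< position σ j
      ⊏⇒position< {i} {j} i⊏j = isLinExt⁻ P Q W σ ext
        (subst₂ (λ u v → T (ltΔ P Q W u v)) (sym (lookup-position σ perm i)) (sym (lookup-position σ perm j)) i⊏j)

      maxAbove<g : ∀ i → ΔW.maxAbove g i ≤ lookup s (position σ i)
      maxAbove<g i = ΔW.maxAbove-lub g i _ (λ j i⊏j → ∈-decreasing⇒decreasing n d s∈ (⊏⇒position< i⊏j))

      point = fromDecreasing W σ s

    positives-fromDecreasing : positives point ≡ W
    positives-fromDecreasing = ≗⇒≡ (positives point) W λ i → begin
      lookup (positives point) i                                          ≡⟨ lookup-positives point i ⟩
      isPositive (lookup point i)                                         ≡⟨ cong isPositive (lookup-fromHeights W g i) ⟩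
      isPositive (sgn (lookup W i) ℤ.* + (g i ∸ ΔW.maxAbove g i))           ≡⟨ cong (λ k → isPositive (sgn (lookup W i) ℤ.* + k)) (ℕP.+-∸-assoc 1 (maxAbove<g i)) ⟩
      isPositive (sgn (lookup W i) ℤ.* + suc (lookup s (position σ i) ∸ ΔW.maxAbove g i)) ≡⟨ isPositive-sgn-* (lookup W i) _ ⟩
      lookup W i                                                          ∎
      where open ≡-Reasoning

    height-fromDecreasing : ∀ i → height point i ≡ g i
    height-fromDecreasing = subst (λ W′ → ∀ i → Height.height (Δ W′) (magnitudes point) i ≡ g i) (sym positives-fromDecreasing)
      (height-fromHeights W g (λ i → ℕP.m≤n⇒m≤1+n (maxAbove<g i)))

    bounded-fromDecreasing : Bounded n point
    bounded-fromDecreasing i = ℕP.≤-trans (ℕP.≤-reflexive (height-fromDecreasing i)) (∈-decreasing⇒< n d s∈ (position σ i))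

  fromDecreasing-injective : ∀ {n W W′ σ σ′ s s′} → IsLinearExtension W σ → IsLinearExtension W′ σ′ →
    s ∈ decreasing n d → s′ ∈ decreasing n d → fromDecreasing W σ s ≡ fromDecreasing W′ σ′ s′ → W ≡ W′ × σ ≡ σ′ × s ≡ s′
  fromDecreasing-injective {n} {W} {W′} {σ} {σ′} {s} {s′} σ-ext σ′-ext s∈ s′∈ eq
    with trans (sym (L.positives-fromDecreasing)) (trans (cong positives eq) L′.positives-fromDecreasing)
    where
    module L  = Lower {n} {W} {σ} {s} σ-ext s∈
    module L′ = Lower {n} {W′} {σ′} {s′} σ′-ext s′∈
  ... | refl = refl , σ≡σ′ , s≡s′
    where
    module L  = Lower {n} {W} {σ} {s} σ-ext s∈
    module L′ = Lower {n} {W′} {σ′} {s′} σ′-ext s′∈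
    perm  = proj₁ (to (T-∧ {isPerm σ}) σ-ext)
    perm′ = proj₁ (to (T-∧ {isPerm σ′}) σ′-ext)
    π : Fin d → Fin d
    π a = position σ′ (lookup σ a)
    s′∘π≡s : ∀ a → lookup s′ (π a) ≡ lookup s a
    s′∘π≡s a = sym (trans (cong (lookup s) (sym (position-lookup σ perm a)))
      (ℕP.suc-injective (trans (sym (L.height-fromDecreasing (lookup σ a)))
                               (trans (cong (λ z → height z (lookup σ a)) eq) (L′.height-fromDecreasing (lookup σ a))))))
    π-mono : ∀ {a b} → a Fin.< b → π a Fin.< π b
    π-mono {a} {b} a<b with ℕP.<-cmp (toℕ (π a)) (toℕ (π b))
    ... | tri< πa<πb _ _ = πa<πb
    ... | tri≈ _ πa≡πb _ = ⊥-elim (ℕP.<-irrefl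
          (trans (sym (s′∘π≡s b)) (trans (cong (lookup s′) (sym (FinP.toℕ-injective πa≡πb))) (s′∘π≡s a)))
          (∈-decreasing⇒decreasing n d s∈ a<b))
    ... | tri> _ _ πb<πa = ⊥-elim (ℕP.<-asym (subst₂ _<_ (sym (s′∘π≡s b)) (sym (s′∘π≡s a)) (∈-decreasing⇒decreasing n d s∈ a<b))
                                             (∈-decreasing⇒decreasing n d s′∈ πb<πa))
    π≡id : ∀ a → π a ≡ a
    π≡id = FinSort.strictMono⇒id π π-mono
    σ≡σ′ : σ ≡ σ′
    σ≡σ′ = ≗⇒≡ σ σ′ (λ a → trans (sym (lookup-position σ′ perm′ (lookup σ a))) (cong (lookup σ′) (π≡id a)))
    s≡s′ : s ≡ s′
    s≡s′ = ≗⇒≡ s s′ (λ a → trans (sym (s′∘π≡s a)) (cong (lookup s′) (π≡id a)))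

  fromNonIncreasing : Subset d → Vec (Fin d) d → Vec ℕ d → Vec ℤ d
  fromNonIncreasing W σ t = fromHeights W (λ i → lookup t (position σ i))

  module Upper {n z} (bounded : Bounded n z) where

    private
      W = positives z
      module ΔW = Height (Δ W)
      H = height z

      κ : Fin d → ℕ
      κ i = (H i * d + ΔW.above i) * d + toℕ i

      κ-⊏ : ∀ {i j} → T (i ΔW.⊏ j) → κ j < κ i
      κ-⊏ {i} {j} i⊏j = radix-<ˡ d
        (radix-<ʳ d (ℕP.≤-trans (ΔW.≤-maxAbove H i⊏j) (ΔW.maxAbove≤height (magnitudes z) i)) (ΔW.⊏⇒above> i⊏j))
        (FinP.toℕ<n j)

      κ<⇒H≤ : ∀ {i j} → κ j < κ i → H j ≤ H i
      κ<⇒H≤ {i} {j} κj<κi = ℕP.≮⇒≥ (λ Hi<Hj → ℕP.<-asym κj<κi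
        (radix-<ˡ d (radix-<ˡ d Hi<Hj (ΔW.above<d i)) (FinP.toℕ<n i)))

      κ-injective : ∀ {i j} → κ i ≡ κ j → i ≡ j
      κ-injective {i} {j} κi≡κj = FinP.toℕ-injective (proj₂ (radix-injective d {H i * d + ΔW.above i} {H j * d + ΔW.above j} (FinP.toℕ<n i) (FinP.toℕ<n j) κi≡κj))

      open FinSort.SortByKey κ κ-injective using (sorted; sorted-injective; sorted-reflects; sorted-decreasing)

    σ : Vec (Fin d) d
    σ = tabulate sorted

    t : Vec ℕ d
    t = tabulate (λ a → H (sorted a))

    private
      lookup-σ : ∀ a → lookup σ a ≡ sorted a
      lookup-σ a = VecP.lookup∘tabulate sorted a

      lookup-t : ∀ a → lookup t a ≡ H (sorted a)
      lookup-t a = VecP.lookup∘tabulate (λ a → H (sorted a)) a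

      perm : T (isPerm σ)
      perm = isPerm⁺ σ (λ {a} {b} σa≡σb → sorted-injective (trans (sym (lookup-σ a)) (trans σa≡σb (lookup-σ b))))

    σ-linearExtension : IsLinearExtension W σ
    σ-linearExtension = from (T-∧ {isPerm σ}) (perm , isLinExt⁺ P Q W σ (λ {a} {b} σa⊏σb →
      sorted-reflects (κ-⊏ (subst₂ (λ u v → T (u ΔW.⊏ v)) (lookup-σ a) (lookup-σ b) σa⊏σb))))

    t∈nonIncreasing : t ∈ nonIncreasing (suc n) d
    t∈nonIncreasing = ∈-nonIncreasing⁺ (suc n) d t
      (λ a → s≤s (ℕP.≤-trans (ℕP.≤-reflexive (lookup-t a)) (bounded (sorted a))))
      (λ {a} {b} a<b → subst₂ _≤_ (sym (lookup-t b)) (sym (lookup-t a)) (κ<⇒H≤ (sorted-decreasing a<b)))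

    fromNonIncreasing≡ : fromNonIncreasing W σ t ≡ z
    fromNonIncreasing≡ = ≗⇒≡ _ z λ i → begin
      lookup (fromHeights W g) i                          ≡⟨ lookup-fromHeights W g i ⟩
      sgn (lookup W i) ℤ.* + (g i ∸ ΔW.maxAbove g i)       ≡⟨ cong (λ k → sgn (lookup W i) ℤ.* + k) (cong₂ _∸_ (g≗H i) (ΔW.maxAbove-cong g H i (λ j _ → g≗H j))) ⟩
      sgn (lookup W i) ℤ.* + (H i ∸ ΔW.maxAbove H i)       ≡⟨ cong (λ k → sgn (lookup W i) ℤ.* + (k ∸ ΔW.maxAbove H i)) (ΔW.height-rec (magnitudes z) i) ⟩
      sgn (lookup W i) ℤ.* + (magnitudes z i + ΔW.maxAbove H i ∸ ΔW.maxAbove H i)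
                                                          ≡⟨ cong (λ k → sgn (lookup W i) ℤ.* + k) (ℕP.m+n∸n≡m (magnitudes z i) (ΔW.maxAbove H i)) ⟩
      sgn (lookup W i) ℤ.* + magnitudes z i               ≡⟨ cong (λ b → sgn b ℤ.* + magnitudes z i) (lookup-positives z i) ⟩
      sgn (isPositive (lookup z i)) ℤ.* + ℤ.∣ lookup z i ∣ ≡⟨ sgn-isPositive-*-abs (lookup z i) ⟩
      lookup z i                                          ∎
      where
      open ≡-Reasoning
      g : Fin d → ℕ
      g i = lookup t (position σ i)
      g≗H : ∀ i → g i ≡ H i
      g≗H i = trans (lookup-t (position σ i)) (cong H (trans (sym (lookup-σ (position σ i))) (lookup-position σ perm i)))

  E : ℕ
  E = sum (map (e P Q) (allSubsets d))

  lowerPoints : ℕ → List (Vec ℤ d)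
  lowerPoints n = concatMap (λ W → cartesianProductWith (fromDecreasing W) (linearExtensions W) (decreasing n d)) (allSubsets d)

  upperPoints : ℕ → List (Vec ℤ d)
  upperPoints n = concatMap (λ W → cartesianProductWith (fromNonIncreasing W) (linearExtensions W) (nonIncreasing (suc n) d)) (allSubsets d)

  private
    fromDecreasing-injective′ : ∀ {n W W′ σ σ′ s s′} → σ ∈ linearExtensions W → σ′ ∈ linearExtensions W′ →
      s ∈ decreasing n d → s′ ∈ decreasing n d → fromDecreasing W σ s ≡ fromDecreasing W′ σ′ s′ → W ≡ W′ × σ ≡ σ′ × s ≡ s′
    fromDecreasing-injective′ {W = W} {W′} σ∈ σ′∈ =
      fromDecreasing-injective (∈-linearExtensions⁻ W σ∈) (∈-linearExtensions⁻ W′ σ′∈)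

  Unique-lowerPoints : ∀ n → Unique (lowerPoints n)
  Unique-lowerPoints n = Unique-concatMap _ Unique-allSubsets
    (λ {W} _ → Unique-cartesianProductWith (fromDecreasing W) (Unique-linearExtensions W) (Unique-decreasing n d)
                 (λ σ∈ σ′∈ s∈ s′∈ eq → proj₂ (fromDecreasing-injective′ {n} {W} {W} σ∈ σ′∈ s∈ s′∈ eq)))
    (λ {W} {W′} _ _ z∈ z∈′ → sameW (∈-cartesianProductWith⁻ (fromDecreasing W) (linearExtensions W) _ z∈)
                                    (∈-cartesianProductWith⁻ (fromDecreasing W′) (linearExtensions W′) _ z∈′))
    where
    sameW : ∀ {W W′ z} → ∃ (λ σ → ∃ λ s → σ ∈ linearExtensions W × s ∈ decreasing n d × z ≡ fromDecreasing W σ s) →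
                         ∃ (λ σ → ∃ λ s → σ ∈ linearExtensions W′ × s ∈ decreasing n d × z ≡ fromDecreasing W′ σ s) → W ≡ W′
    sameW {W} {W′} (_ , _ , σ∈ , s∈ , refl) (_ , _ , σ′∈ , s′∈ , eq) = proj₁ (fromDecreasing-injective′ {n} {W} {W′} σ∈ σ′∈ s∈ s′∈ eq)

  lowerPoints⊆latticePoints : ∀ n {z} → z ∈ lowerPoints n → z ∈ latticePoints n
  lowerPoints⊆latticePoints n z∈ with ∈-concatMap⁻′ _ (allSubsets d) z∈
  ... | W , _ , z∈W with ∈-cartesianProductWith⁻ (fromDecreasing W) (linearExtensions W) _ z∈W
  ...   | σ , s , σ∈ , s∈ , refl = ∈-latticePoints⁺ n _ (Lower.bounded-fromDecreasing {n} {W} {σ} {s} (∈-linearExtensions⁻ W σ∈) s∈)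

  latticePoints⊆upperPoints : ∀ n {z} → z ∈ latticePoints n → z ∈ upperPoints n
  latticePoints⊆upperPoints n {z} z∈ = ∈-concatMap⁺′ _ (∈-allSubsets (positives z))
    (subst (_∈ cartesianProductWith (fromNonIncreasing (positives z)) (linearExtensions (positives z)) (nonIncreasing (suc n) d))
           U.fromNonIncreasing≡
           (∈-cartesianProductWith⁺ (fromNonIncreasing (positives z)) (∈-linearExtensions⁺ (positives z) U.σ-linearExtension) U.t∈nonIncreasing))
    where
    module U = Upper {n} {z} (∈-latticePoints⁻ n z∈)

  length-points : ∀ {A : Set} (f : Subset d → Vec (Fin d) d → A → Vec ℤ d) (xs : List A) →
    length (concatMap (λ W → cartesianProductWith (f W) (linearExtensions W) xs) (allSubsets d)) ≡ E * length xs
  length-points f xs = length-concatMap _ (e P Q) (length xs) (allSubsets d) (λ W → length-cartesianProductWith (f W) (linearExtensions W) xs)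

  E*decreasing≤latticePoints : ∀ n → E * length (decreasing n d) ≤ length (latticePoints n)
  E*decreasing≤latticePoints n = ℕP.≤-trans (ℕP.≤-reflexive (sym (length-points fromDecreasing (decreasing n d))))
    (Unique⇒length≤ (Unique-lowerPoints n) (lowerPoints⊆latticePoints n))

  latticePoints≤E*nonIncreasing : ∀ n → length (latticePoints n) ≤ E * length (nonIncreasing (suc n) d)
  latticePoints≤E*nonIncreasing n = ℕP.≤-trans (Unique⇒length≤ (Unique-latticePoints n) (latticePoints⊆upperPoints n))
    (ℕP.≤-reflexive (length-points fromNonIncreasing (nonIncreasing (suc n) d)))

  latticePoints-lower : ∀ n → d ≤ n → E * (n ∸ d) ^ d ≤ d ! * length (latticePoints n)
  latticePoints-lower n d≤n = begin
    E * (n ∸ d) ^ d                                ≤⟨ ℕP.*-monoʳ-≤ E (^≤!*length-decreasing d (n ∸ d)) ⟩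
    E * (d ! * length (decreasing (n ∸ d + d) d))  ≡⟨ cong (λ k → E * (d ! * length (decreasing k d))) (ℕP.m∸n+n≡m d≤n) ⟩
    E * (d ! * length (decreasing n d))            ≡⟨ x∙yz≈y∙xz E (d !) _ ⟩
    d ! * (E * length (decreasing n d))            ≤⟨ ℕP.*-monoʳ-≤ (d !) (E*decreasing≤latticePoints n) ⟩
    d ! * length (latticePoints n)                 ∎
    where open ℕP.≤-Reasoning

  latticePoints-upper : ∀ n → d ! * length (latticePoints n) ≤ E * (n + suc d) ^ d
  latticePoints-upper n = begin
    d ! * length (latticePoints n)                      ≤⟨ ℕP.*-monoʳ-≤ (d !) (latticePoints≤E*nonIncreasing n) ⟩
    d ! * (E * length (nonIncreasing (suc n) d))        ≡⟨ x∙yz≈y∙xz (d !) E _ ⟩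
    E * (d ! * length (nonIncreasing (suc n) d))        ≤⟨ ℕP.*-monoʳ-≤ E (!*length-nonIncreasing≤^ d (suc n)) ⟩
    E * (suc n + d) ^ d                                 ≡⟨ cong (λ k → E * k ^ d) (sym (ℕP.+-suc n d)) ⟩
    E * (n + suc d) ^ d                                 ∎
    where open ℕP.≤-Reasoning

module Asymptotics where

  open import Data.Nat as ℕ using (ℕ; zero; suc; _≤_; _<_; s≤s; _∸_; _+_; _*_; _^_; _!)
  open import Data.Nat.Properties
  open import Data.Nat.Solver using (module +-*-Solver)
  open import Data.Integer as ℤ using (ℤ; +_; -[1+_]; _⊖_)
  import Data.Integer.Properties as ℤP
  open import Data.Rational as ℚ using (ℚ; mkℚ; _-_; ∣_∣; toℚᵘ; fromℚᵘ)
  import Data.Rational.Properties as ℚP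
  open import Data.Rational.Unnormalised as ℚᵘ using (mkℚᵘ; *<*)
  import Data.Rational.Unnormalised.Properties as ℚᵘP
  open import Data.Nat.Coprimality using (Coprime)
  open import Data.Product using (∃; _×_; _,_)
  open import Data.Sum using (inj₁; inj₂)
  open import Data.Empty using (⊥-elim)
  open import Relation.Binary.PropositionalEquality
  open import Defs using (Point; GridCount; HasVolume)
  open IntegerEmbedding using (fromℚᵘ-homo-+; fromℚᵘ-homo‿-)
  open Arithmetic using (*-+-^-upper)
  open +-*-Solver using (solve; _:+_; _:*_; _:=_; con)

  ∣⊖∣≡∣-∣ : ∀ m n → ℤ.∣ m ⊖ n ∣ ≡ ℕ.∣ m - n ∣
  ∣⊖∣≡∣-∣ m n with ≤-total m n
  ... | inj₁ m≤n = trans (ℤP.∣⊖∣-≤ m≤n) (sym (m≤n⇒∣m-n∣≡n∸m m≤n))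
  ... | inj₂ n≤m = trans (ℤP.∣m⊖n∣≡∣n⊖m∣ m n) (trans (ℤP.∣⊖∣-≤ n≤m) (sym (m≤n⇒∣n-m∣≡n∸m n≤m)))

  ∣c/a-e/b∣<ε : ∀ c e a b .{{_ : ℕ.NonZero a}} .{{_ : ℕ.NonZero b}} p q .(cop : Coprime (suc p) (suc q)) →
    ℕ.∣ c * b - e * a ∣ * suc q < suc p * (a * b) →
    ∣ (+ c) ℚ./ a - (+ e) ℚ./ b ∣ ℚ.< mkℚ (+ suc p) q cop
  ∣c/a-e/b∣<ε c e (suc a) (suc b) p q cop bound = ℚP.toℚᵘ-cancel-< (ℚᵘP.<-respˡ-≃ (ℚᵘP.≃-sym toℚᵘ-difference) difference<ε)
    where
    difference = mkℚᵘ (+ c) a ℚᵘ.+ (ℚᵘ.- mkℚᵘ (+ e) b)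
    toℚᵘ-difference : toℚᵘ ∣ (+ c) ℚ./ suc a - (+ e) ℚ./ suc b ∣ ℚᵘ.≃ ℚᵘ.∣ difference ∣
    toℚᵘ-difference = ℚᵘP.≃-trans (ℚP.toℚᵘ-homo-∣-∣ _) (ℚᵘP.∣-∣-cong (ℚᵘP.≃-trans (ℚP.toℚᵘ-cong
      (sym (trans (fromℚᵘ-homo-+ (mkℚᵘ (+ c) a) (ℚᵘ.- mkℚᵘ (+ e) b)) (cong (λ s → fromℚᵘ (mkℚᵘ (+ c) a) ℚ.+ s) (fromℚᵘ-homo‿- (mkℚᵘ (+ e) b))))))
      (ℚP.toℚᵘ-fromℚᵘ difference)))
    numerator : ℤ.∣ + c ℤ.* + suc b ℤ.+ ℤ.- (+ e) ℤ.* + suc a ∣ ≡ ℕ.∣ c * suc b - e * suc a ∣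
    numerator = trans (cong ℤ.∣_∣ (trans (cong₂ ℤ._+_ (sym (ℤP.pos-* c (suc b)))
        (trans (sym (ℤP.neg-distribˡ-* (+ e) (+ suc a))) (cong ℤ.-_ (sym (ℤP.pos-* e (suc a))))))
      (ℤP.m-n≡m⊖n (c * suc b) (e * suc a)))) (∣⊖∣≡∣-∣ (c * suc b) (e * suc a))
    difference<ε : ℚᵘ.∣ difference ∣ ℚᵘ.< mkℚᵘ (+ suc p) q
    difference<ε = *<* (subst₂ ℤ._<_
      (trans (ℤP.pos-* (ℕ.∣ c * suc b - e * suc a ∣) (suc q)) (cong (λ k → + k ℤ.* + suc q) (sym numerator)))
      (ℤP.pos-* (suc p) (suc a * suc b)) (ℤ.+<+ bound))

  [m*n]^k≡m^k*n^k : ∀ m n k → (m * n) ^ k ≡ m ^ k * n ^ k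
  [m*n]^k≡m^k*n^k m n zero    = refl
  [m*n]^k≡m^k*n^k m n (suc k) = trans (cong (m * n *_) ([m*n]^k≡m^k*n^k m n k))
    (solve 4 (λ m n p q → m :* n :* (p :* q) := m :* p :* (n :* q)) refl m n (m ^ k) (n ^ k))

  slack : ℕ → ℕ → ℕ
  slack d e = e * (d * suc d) * 2 ^ d

  ∣-∣≤ : ∀ {u v w} → u ≤ v + w → v ≤ u + w → ℕ.∣ u - v ∣ ≤ w
  ∣-∣≤ {u} {v} u≤v+w v≤u+w with ≤-total u v
  ... | inj₁ u≤v = ≤-trans (≤-reflexive (m≤n⇒∣m-n∣≡n∸m u≤v)) (m≤n+o⇒m∸n≤o v u v≤u+w)
  ... | inj₂ v≤u = ≤-trans (≤-reflexive (m≤n⇒∣n-m∣≡n∸m v≤u)) (m≤n+o⇒m∸n≤o u v u≤v+w)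

  upper-estimate : ∀ d e c n → d < n → d ! * c ≤ e * (n + suc d) ^ d → n * (d ! * c) ≤ n * (e * n ^ d) + slack d e * n ^ d
  upper-estimate d e c n d<n upper = begin
    n * (d ! * c)                                  ≤⟨ *-monoʳ-≤ n upper ⟩
    n * (e * (n + suc d) ^ d)                      ≡⟨ solve 3 (λ n e b → n :* (e :* b) := e :* (n :* b)) refl n e ((n + suc d) ^ d) ⟩
    e * (n * (n + suc d) ^ d)                      ≤⟨ *-monoʳ-≤ e (*-+-^-upper n (suc d) d) ⟩
    e * (n * n ^ d + d * suc d * (n + suc d) ^ d)  ≤⟨ *-monoʳ-≤ e (+-monoʳ-≤ (n * n ^ d) (*-monoʳ-≤ (d * suc d) [n+1+d]^d≤2^d*n^d)) ⟩
    e * (n * n ^ d + d * suc d * (2 ^ d * n ^ d))  ≡⟨ solve 5 (λ e n p m t → e :* (n :* p :+ m :* (t :* p)) := n :* (e :* p) :+ e :* m :* t :* p)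
                                                       refl e n (n ^ d) (d * suc d) (2 ^ d) ⟩
    n * (e * n ^ d) + slack d e * n ^ d            ∎
    where
    open ≤-Reasoning
    [n+1+d]^d≤2^d*n^d : (n + suc d) ^ d ≤ 2 ^ d * n ^ d
    [n+1+d]^d≤2^d*n^d = ≤-trans (^-monoˡ-≤ d (≤-trans (+-monoʳ-≤ n d<n) (≤-reflexive (solve 1 (λ n → n :+ n := con 2 :* n) refl n))))
                                (≤-reflexive ([m*n]^k≡m^k*n^k 2 n d))

  lower-estimate : ∀ d e c n → d < n → e * (n ∸ d) ^ d ≤ d ! * c → n * (e * n ^ d) ≤ n * (d ! * c) + slack d e * n ^ d
  lower-estimate d e c n d<n lower = begin
    n * (e * n ^ d)                                   ≡⟨ solve 3 (λ n e p → n :* (e :* p) := e :* (n :* p)) refl n e (n ^ d) ⟩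
    e * (n * n ^ d)                                   ≡⟨ cong (λ k → e * (k * n ^ d)) (sym a+d≡n) ⟩
    e * ((a + d) * n ^ d)                             ≡⟨ cong (e *_) (*-distribʳ-+ (n ^ d) a d) ⟩
    e * (a * n ^ d + d * n ^ d)                       ≡⟨ cong (λ k → e * (a * k ^ d + d * n ^ d)) (sym a+d≡n) ⟩
    e * (a * (a + d) ^ d + d * n ^ d)                 ≤⟨ *-monoʳ-≤ e (+-monoˡ-≤ (d * n ^ d) (*-+-^-upper a d d)) ⟩
    e * ((a * a ^ d + d * d * (a + d) ^ d) + d * n ^ d) ≡⟨ cong (λ k → e * ((a * a ^ d + d * d * k ^ d) + d * n ^ d)) a+d≡n ⟩
    e * ((a * a ^ d + d * d * n ^ d) + d * n ^ d)     ≤⟨ *-monoʳ-≤ e (+-monoˡ-≤ (d * n ^ d) (+-monoˡ-≤ (d * d * n ^ d) (*-monoˡ-≤ (a ^ d) (m∸n≤m n d)))) ⟩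
    e * ((n * a ^ d + d * d * n ^ d) + d * n ^ d)     ≡⟨ solve 5 (λ e n q dd p → e :* ((n :* q :+ dd :* dd :* p) :+ dd :* p) := n :* (e :* q) :+ e :* (dd :* (con 1 :+ dd)) :* p)
                                                          refl e n (a ^ d) d (n ^ d) ⟩
    n * (e * a ^ d) + e * (d * suc d) * n ^ d         ≤⟨ +-mono-≤ (*-monoʳ-≤ n lower) (*-monoʳ-≤ (e * (d * suc d)) (m≤n*m (n ^ d) (2 ^ d) {{m^n≢0 2 d}})) ⟩
    n * (d ! * c) + e * (d * suc d) * (2 ^ d * n ^ d) ≡⟨ cong (λ k → n * (d ! * c) + k) (sym (*-assoc (e * (d * suc d)) (2 ^ d) (n ^ d))) ⟩
    n * (d ! * c) + slack d e * n ^ d                 ∎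
    where
    open ≤-Reasoning
    a = n ∸ d
    a+d≡n : a + d ≡ n
    a+d≡n = m∸n+n≡m (<⇒≤ d<n)

  scaledError≤ : ∀ d e c n → d < n → e * (n ∸ d) ^ d ≤ d ! * c → d ! * c ≤ e * (n + suc d) ^ d →
    n * ℕ.∣ d ! * c - e * n ^ d ∣ ≤ slack d e * n ^ d
  scaledError≤ d e c n d<n lower upper =
    ≤-trans (≤-reflexive (*-distribˡ-∣-∣ n (d ! * c) (e * n ^ d)))
            (∣-∣≤ (upper-estimate d e c n d<n upper) (lower-estimate d e c n d<n lower))

  Sandwiched : ∀ {d} → (Point d → Set) → ℕ → Set
  Sandwiched {d} K e = ∀ m → d ≤ m → ∃ λ c → GridCount K (suc m) c × e * (suc m ∸ d) ^ d ≤ d ! * c × d ! * c ≤ e * (suc m + suc d) ^ d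

  sandwiched⇒HasVolume : ∀ {d} (K : Point d → Set) e → Sandwiched K e → HasVolume K (ℚ._/_ (+ e) (d !) {{d !≢0}})
  sandwiched⇒HasVolume {d} K e sandwiched (mkℚ (+ zero) _ _)   0<ε = ⊥-elim (ℤ.Positive.pos (ℚ.positive 0<ε))
  sandwiched⇒HasVolume {d} K e sandwiched (mkℚ -[1+ _ ] _ _)   0<ε = ⊥-elim (ℤ.Positive.pos (ℚ.positive 0<ε))
  sandwiched⇒HasVolume {d} K e sandwiched (mkℚ (+ suc p) q cop) 0<ε = slack d e * suc q + suc d , close
    where
    -- |c/nᵈ − e/d!| ≤ slack/(n·d!) < 1/(q+1) ≤ ε as soon as n > slack·(q+1)
    close : ∀ n → slack d e * suc q + suc d ≤ n → (nz : ℕ.NonZero n) → ∃ λ c → GridCount K n {{nz}} c ×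
            (∣ ℚ._/_ (+ c) (n ^ d) {{m^n≢0 n d {{nz}}}} - ℚ._/_ (+ e) (d !) {{d !≢0}} ∣ ℚ.< mkℚ (+ suc p) q cop)
    close (suc m) N≤n _ with sandwiched m (≤-pred (≤-trans (m≤n+m (suc d) _) N≤n))
    ... | c , grid , lower , upper = c , grid ,
      ∣c/a-e/b∣<ε c e (n ^ d) (d !) {{m^n≢0 n d}} {{d !≢0}} p q cop (*-cancelˡ-< n _ _ (begin-strict
        n * (ℕ.∣ c * d ! - e * n ^ d ∣ * suc q)      ≡⟨ sym (*-assoc n (ℕ.∣ c * d ! - e * n ^ d ∣) (suc q)) ⟩
        n * ℕ.∣ c * d ! - e * n ^ d ∣ * suc q        ≡⟨ cong (λ k → n * ℕ.∣ k - e * n ^ d ∣ * suc q) (*-comm c (d !)) ⟩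
        n * ℕ.∣ d ! * c - e * n ^ d ∣ * suc q        ≤⟨ *-monoˡ-≤ (suc q) (scaledError≤ d e c n d<n lower upper) ⟩
        slack d e * n ^ d * suc q                    ≡⟨ solve 3 (λ s p q → s :* p :* q := s :* q :* p) refl (slack d e) (n ^ d) (suc q) ⟩
        slack d e * suc q * n ^ d                    <⟨ *-monoˡ-< (n ^ d) {{m^n≢0 n d}} slack*q<n ⟩
        n * n ^ d                                    ≤⟨ *-monoʳ-≤ n (≤-trans (m≤m*n (n ^ d) (d !) {{d !≢0}}) (m≤n*m (n ^ d * d !) (suc p))) ⟩
        n * (suc p * (n ^ d * d !))                  ∎))
      where
      open ≤-Reasoning
      n = suc m
      d<n : d < n
      d<n = ≤-trans (m≤n+m (suc d) _) N≤n
      slack*q<n : slack d e * suc q < n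
      slack*q<n = ≤-trans (s≤s (m≤m+n (slack d e * suc q) d)) (≤-trans (≤-reflexive (sym (+-suc (slack d e * suc q) d))) N≤n)

open import Data.Nat using (suc)
open import Data.Nat.Properties using (m≤n⇒m≤1+n)
open import Data.List using (length)
open import Data.Product using (_,_)
open import Function using (_∘_; mk⇔)
import Relation.Binary.PropositionalEquality as ≡
open import Defs
open Asymptotics using (Sandwiched; sandwiched⇒HasVolume)

theorem1p3 : (d : ℕ) (P Q : FinPoset d) → HasVolume (Gamma P Q) (rhs P Q)
theorem1p3 d P Q = sandwiched⇒HasVolume (Gamma P Q) E sandwiched
  where
  open LatticePoints P Q using (Bounded⇒Γ; Γ⇒Bounded)
  open Counting P Q
  sandwiched : Sandwiched (Gamma P Q) E
  sandwiched m d≤m =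
    length (latticePoints (suc m)) , gridCount , latticePoints-lower (suc m) (m≤n⇒m≤1+n d≤m) , latticePoints-upper (suc m)
    where
    gridCount : GridCount (Gamma P Q) (suc m) (length (latticePoints (suc m)))
    gridCount = latticePoints (suc m) , Unique-latticePoints (suc m) ,
      (λ z → mk⇔ (Bounded⇒Γ z m ∘ ∈-latticePoints⁻ (suc m)) (∈-latticePoints⁺ (suc m) z ∘ Γ⇒Bounded z m)) , ≡.refl
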